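{- Let $r\ge1$. Then: (1) $\operatorname{O}^{(r+1)}_{\mathfrak{f}}=\sum_{k=0}^{n-1}[\operatorname{D}_{\mathfrak{f}}(t^k)*\operatorname{O}^{(r)}_{\mathfrak{f}}]\,X_{r+1}^k$; (2) in particular, the coefficient of $X_{r+1}^{n-1}$ in $\operatorname{O}^{(r+1)}_{\mathfrak{f}}(X_1,\dots,X_{r+1})$ is $\operatorname{O}^{(r)}_{\mathfrak{f}}(X_1,\dots,X_r)$; (3) $\operatorname{O}^{(r+1)}_{\mathfrak{f}}=\sum_{k=0}^{n-1}[t^k*\operatorname{O}^{(r)}_{\mathfrak{f}}]\,\operatorname{D}_{\mathfrak{f}}(X_{r+1}^k)$.
   Context: Let $\mathbb{F}_q$ be a finite field and $\mathfrak{f}(t)=a_nt^n+\cdots+a_0\in\mathbb{F}_q[t]$ monic of degree $n\ge1$. For a variable $X$ (including $t$), $\operatorname{D}_{\mathfrak{f}}$ is the $\mathbb{F}_q$-linear map on polynomials of degree $<n$ with $\operatorname{D}_{\mathfrak{f}}(X^i)=\sum_{j=0}^{n-i-1}a_{i+j+1}X^j$. Weil operators: $\operatorname{O}^{(1)}_{\mathfrak{f}}=1$; $\operatorname{O}^{(2)}_{\mathfrak{f}}(X_1,X_2)=\sum_{k=0}^{n-1}\operatorname{D}_{\mathfrak{f}}(X_1^k)X_2^k$; for $s>2$, $\operatorname{O}^{(s)}_{\mathfrak{f}}(X_1,\dots,X_s)$ is the unique polynomial whose degree in each $X_i$ is $<n$ and which is congruent to $\prod_{j=1}^{s-1}\operatorname{O}^{(2)}_{\mathfrak{f}}(X_j,X_s)$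 modulo $\mathfrak{f}(X_s)$. For $g(t)\in\mathbb{F}_q[t]$, $[g(t)*\operatorname{O}^{(r)}_{\mathfrak{f}}]$ denotes the unique polynomial in $\mathbb{F}_q[X_1,\dots,X_r]$ with all $X_i$-degrees $<n$ congruent to $g(X_i)\operatorname{O}^{(r)}_{\mathfrak{f}}$ modulo $(\mathfrak{f}(X_1),\dots,\mathfrak{f}(X_r))$; this is independent of the choice of $i\in\{1,\dots,r\}$. -}

module Defs where

open import Level using (Level; _⊔_)
open import Algebra.Bundles using (CommutativeRing)
open import Data.Nat.Base as ℕ using (ℕ; zero; suc; _∸_; _≡ᵇ_)
open import Data.Bool.Base using (if_then_else_)
open import Data.List.Base as List using (List; []; _∷_; _++_; upTo)
open import Data.Vec.Base as Vec using (Vec)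
open import Data.Fin.Base using (Fin)
open import Data.Product.Base using (Σ)
open import Relation.Nullary using (¬_)

-- k-th coefficient of a coefficient list (lowest degree first),
-- with the given zero past the end.
coeffL : ∀ {a} {A : Set a} → A → List A → ℕ → A
coeffL z []       _       = z
coeffL z (x ∷ xs) zero    = x
coeffL z (x ∷ xs) (suc k) = coeffL z xs k

record IsFiniteField {c ℓ} (R : CommutativeRing c ℓ) : Set (c ⊔ ℓ) where
  open CommutativeRing R
  field
    0≉1       : ¬ (0# ≈ 1#)
    inverse   : ∀ x → ¬ (x ≈ 0#) → Σ Carrier λ y → x * y ≈ 1#
    size      : ℕ
    enum      : Fin size → Carrier
    enum-surj : ∀ x → Σ (Fin size) λ i → enum i ≈ x

record Ops {c} (A : Set c) : Set c where
  field
    z o : A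
    add mul : A → A → A
    neg : A → A

-- Univariate polynomials (coefficient lists, lowest degree first).
module _ {c} {A : Set c} (O : Ops A) where
  open Ops O
  addL : List A → List A → List A
  addL []       ys       = ys
  addL (x ∷ xs) []       = x ∷ xs
  addL (x ∷ xs) (y ∷ ys) = add x y ∷ addL xs ys

  mulL : List A → List A → List A
  mulL []       ys = []
  mulL (x ∷ xs) ys = addL (List.map (mul x) ys) (z ∷ mulL xs ys)

  listOps : Ops (List A)
  listOps = record { z = [] ; o = o ∷ [] ; add = addL ; mul = mulL
                   ; neg = List.map neg }

-- Everything below depends on the ring R and on the monic polynomial
--   f(t) = t^n + a_{n-1} t^{n-1} + ... + a_0,   n = suc m ≥ 1,
-- given by the vector a = (a_0, ..., a_{n-1}).
module Weil {c ℓ} (R : CommutativeRing c ℓ) {m : ℕ}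
            (a : Vec (CommutativeRing.Carrier R) (suc m)) where
  open CommutativeRing R using (_≈_; _+_; _*_; -_; 0#; 1#) renaming (Carrier to K)

  n : ℕ
  n = suc m

  -- a_i for all i : a_n = 1 and a_i = 0 for i > n.
  coef : ℕ → K
  coef = coeffL 0# (Vec.toList a ++ (1# ∷ []))

  -- An element  pol p  of
  -- MPoly (suc r) is a polynomial in the last variable X_{r+1} whose
  -- coefficient list (lowest degree first) p has entries in MPoly r.
  data MPoly : ℕ → Set c where
    cst : K → MPoly zero
    pol : ∀ {r} → List (MPoly r) → MPoly (suc r)

  unpol : ∀ {r} → MPoly (suc r) → List (MPoly r)
  unpol (pol p) = p

  ops : (r : ℕ) → Ops (MPoly r)
  ops zero = record
    { z = cst 0# ; o = cst 1#
    ; add = λ { (cst x) (cst y) → cst (x + y) }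
    ; mul = λ { (cst x) (cst y) → cst (x * y) }
    ; neg = λ { (cst x) → cst (- x) } }
  ops (suc r) = record
    { z = pol (Ops.z L) ; o = pol (Ops.o L)
    ; add = λ p q → pol (Ops.add L (unpol p) (unpol q))
    ; mul = λ p q → pol (Ops.mul L (unpol p) (unpol q))
    ; neg = λ p → pol (Ops.neg L (unpol p)) }
    where L = listOps (ops r)

  pzero : ∀ {r} → MPoly r
  pzero {r} = Ops.z (ops r)

  pone : ∀ {r} → MPoly r
  pone {r} = Ops.o (ops r)

  infixl 6 _+P_
  infixl 7 _*P_
  _+P_ : ∀ {r} → MPoly r → MPoly r → MPoly r
  _+P_ {r} = Ops.add (ops r)

  _*P_ : ∀ {r} → MPoly r → MPoly r → MPoly r
  _*P_ {r} = Ops.mul (ops r)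

  -- Equality of polynomials: equal coefficients (up to trailing zeros).
  infix 4 _≈P_
  _≈P_ : ∀ {r} → MPoly r → MPoly r → Set ℓ
  cst x ≈P cst y = x ≈ y
  pol p ≈P pol q = ∀ k → coeffL pzero p k ≈P coeffL pzero q k

  coeffOuter : ∀ {r} → MPoly (suc r) → ℕ → MPoly r
  coeffOuter p k = coeffL pzero (unpol p) k

  embed : ∀ r → K → MPoly r
  embed zero    x = cst x
  embed (suc r) x = pol (embed r x ∷ [])

  lift : ∀ {r} → MPoly r → MPoly (suc r)
  lift p = pol (p ∷ [])

  -- the variable X_{i+1} (0-based index i < r) in MPoly r
  var : (r : ℕ) → ℕ → MPoly r
  var zero    i = cst 0#
  var (suc r) i = if i ≡ᵇ r then pol (pzero ∷ pone ∷ []) else pol (var r i ∷ [])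

  pow : ∀ {r} → MPoly r → ℕ → MPoly r
  pow x zero    = pone
  pow x (suc k) = x *P pow x k

  eval : ∀ {r} → List K → MPoly r → MPoly r
  eval []       x = pzero
  eval (c ∷ cs) x = embed _ c +P x *P eval cs x

  sumTo : ∀ {r} → ℕ → (ℕ → MPoly r) → MPoly r
  sumTo zero    F = pzero
  sumTo (suc N) F = sumTo N F +P F N

  prodTo : ∀ {r} → ℕ → (ℕ → MPoly r) → MPoly r
  prodTo zero    F = pone
  prodTo (suc N) F = prodTo N F *P F N

  tpow : ℕ → List K
  tpow k = List.replicate k 0# ++ (1# ∷ [])

  D : ℕ → List K
  D i = List.map (λ j → coef (i ℕ.+ j ℕ.+ 1)) (upTo (n ∸ i))

  -- Remainder modulo the monic f (in the outer variable), for
  -- polynomials with coefficients in A (f's coefficients embedded by e).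
  module _ {A : Set c} (O : Ops A) (e : K → A) where
    open Ops O renaming (z to zA; add to addA; mul to mulA; neg to negA)
    -- multiplication by the variable, on remainders, modulo f
    shiftRed : Vec A n → Vec A n
    shiftRed v = Vec.zipWith (λ u ai → addA u (negA (mulA (Vec.last v) (e ai))))
                             (zA Vec.∷ Vec.init v) a

    addHead : A → Vec A n → Vec A n
    addHead x (y Vec.∷ ys) = addA x y Vec.∷ ys

    remV : List A → Vec A n
    remV []       = Vec.replicate n zA
    remV (x ∷ xs) = addHead x (shiftRed (remV xs))

  reduceOuter : ∀ {r} → MPoly (suc r) → MPoly (suc r)
  reduceOuter {r} p = pol (Vec.toList (remV (ops r) (embed r) (unpol p)))

  -- the unique polynomial with all X_i-degrees < n congruent to p
  -- modulo (f(X_1), ..., f(X_r))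
  reduceAll : (r : ℕ) → MPoly r → MPoly r
  reduceAll zero    p = p
  reduceAll (suc r) p = pol (List.map (reduceAll r) (unpol (reduceOuter p)))

  -- O^{(2)}_f(X_{j+1}, X_s) = Σ_{k<n} D_f(X_{j+1}^k) X_s^k   in MPoly s
  O2at : (s : ℕ) → ℕ → MPoly s
  O2at s j = sumTo n (λ k → eval (D k) (var s j) *P pow (var s (s ∸ 1)) k)

  -- Weil operators O^{(s)}_f (s ≥ 1; the value at s = 0 is a dummy)
  Weil : (s : ℕ) → MPoly s
  Weil zero                = pone
  Weil (suc zero)          = pone
  Weil (suc (suc zero))    = O2at 2 0
  Weil (suc (suc (suc s))) =
    reduceOuter (prodTo (suc (suc s)) (λ j → O2at (suc (suc (suc s))) j))

  -- [g(t) * P] for P ∈ MPoly r (r ≥ 1), computed with g(X_r)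
  bracket : (r : ℕ) → List K → MPoly r → MPoly r
  bracket r g P = reduceAll r (eval g (var r (r ∸ 1)) *P P)

{-# OPTIONS --safe #-}
module Submission where

-- O⁽²⁾_f(X, Y) = (f(X) − f(Y)) / (X − Y), so (X − Y) O⁽²⁾_f(X, Y) = f(X) − f(Y):
-- modulo f(Y), multiplying O⁽²⁾_f(X, Y) by Y is the same as multiplying it by X
-- modulo f(X).  Now O⁽ʳ⁺¹⁾_f is the remainder modulo f(X_{r+1}) of
-- A(X_{r+1}) O⁽²⁾_f(X_r, X_{r+1}), where A(X_r) reduces to O⁽ʳ⁾_f modulo f(X_r).
-- Hence the coefficient of X_{r+1}^k in O⁽ʳ⁺¹⁾_f is congruent to
-- D_f(X_r^k) O⁽ʳ⁾_f modulo f(X_r); as it is fully reduced (an invariant carried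
-- along the induction on r), it equals [D_f(t^k) * O⁽ʳ⁾_f].  This is (1); (2) is
-- the case k = n − 1, where D_f(t^{n−1}) = 1, and (3) follows from (1) by
-- expanding D_f(t^k) = Σ_j a_{k+j+1} t^j and exchanging the sums.
-- Nothing uses that the field is finite: all of this holds over any commutative ring.

open import Defs
open import Algebra.Bundles using (CommutativeRing; RawRing)
open import Algebra.Structures using (IsCommutativeRing)
open import Algebra.Morphism.Structures using (IsRingHomomorphism)
import Algebra.Morphism.RingMonomorphism as RingMonomorphism
import Algebra.Properties.CommutativeSemigroup as CommutativeSemigroupProperties
import Algebra.Properties.Ring as RingProperties
import Algebra.Solver.Ring.NaturalCoefficients.Default as SemiringSolver
open import Data.Bool.Base using (true; false)
open import Data.Empty using (⊥-elim)
open import Data.List.Base as List using (List; []; _∷_; _++_; applyUpTo; upTo)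
import Data.List.Properties as List
open import Data.Nat.Base using (ℕ; zero; suc; _∸_; _≤_; _<_; s≤s; _≡ᵇ_)
open import Data.Nat.Properties using (suc-injective)
open import Data.Product.Base using (Σ; _×_; _,_; proj₁; proj₂)
open import Data.Vec.Base as Vec using (Vec)
import Data.Vec.Properties as Vec
open import Function.Base using (case_of_)
open import Level using (_⊔_)
open import Relation.Binary.Bundles using (Setoid)
open import Relation.Binary.PropositionalEquality as ≡ using (_≡_)
import Relation.Binary.Reasoning.Setoid as ≈-Reasoning
open import Relation.Binary.Structures using (IsEquivalence)
open import Relation.Nullary using (yes; no; ¬_)

module CoefficientList
  {c ℓ} {A : Set c} (O : Ops A) (_≈ᴬ_ : A → A → Set ℓ)
  (isCommutativeRing : IsCommutativeRing _≈ᴬ_ (Ops.add O) (Ops.mul O) (Ops.neg O) (Ops.z O) (Ops.o O))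
  where

  private
    base : CommutativeRing c ℓ
    base = record { isCommutativeRing = isCommutativeRing }
  open CommutativeRing base hiding (isCommutativeRing)
  open RingProperties ring using (-0#≈0#)
  open CommutativeSemigroupProperties +-commutativeSemigroup using (interchange)

  infix  4 _≋_
  infixl 6 _+ₗ_
  infixl 7 _*ₗ_

  _+ₗ_ _*ₗ_ : List A → List A → List A
  _+ₗ_ = addL O
  _*ₗ_ = mulL O

  -ₗ_ : List A → List A
  -ₗ_ = List.map (-_)

  scale : A → List A → List A
  scale x = List.map (x *_)

  coeff : List A → ℕ → A
  coeff = coeffL 0#

  record _≋_ (p q : List A) : Set ℓ where
    constructor coeffwise
    field coeff-≈ : ∀ k → coeff p k ≈ coeff q k
  open _≋_ public

  ≋-isEquivalence : IsEquivalence _≋_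
  ≋-isEquivalence = record
    { refl  = coeffwise λ _ → refl
    ; sym   = λ e → coeffwise λ k → sym (coeff-≈ e k)
    ; trans = λ e f → coeffwise λ k → trans (coeff-≈ e k) (coeff-≈ f k)
    }

  ≋-setoid : Setoid c ℓ
  ≋-setoid = record { isEquivalence = ≋-isEquivalence }

  module ≋ = IsEquivalence ≋-isEquivalence
  module ≋-Reasoning = ≈-Reasoning ≋-setoid

  ∷-cong : ∀ {x y p q} → x ≈ y → p ≋ q → x ∷ p ≋ y ∷ q
  ∷-cong x≈y p≋q = coeffwise λ { zero → x≈y ; (suc k) → coeff-≈ p≋q k }

  ∷-injective : ∀ {x y p q} → x ∷ p ≋ y ∷ q → x ≈ y × p ≋ q
  ∷-injective e = coeff-≈ e 0 , coeffwise λ k → coeff-≈ e (suc k)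

  0∷[]≋[] : 0# ∷ [] ≋ []
  0∷[]≋[] = coeffwise λ { zero → refl ; (suc k) → refl }

  coeff-+ₗ : ∀ p q k → coeff (p +ₗ q) k ≈ coeff p k + coeff q k
  coeff-+ₗ []      q       k       = sym (+-identityˡ _)
  coeff-+ₗ (x ∷ p) []      k       = sym (+-identityʳ _)
  coeff-+ₗ (x ∷ p) (y ∷ q) zero    = refl
  coeff-+ₗ (x ∷ p) (y ∷ q) (suc k) = coeff-+ₗ p q k

  coeff-map : ∀ (g : A → A) → g 0# ≈ 0# → ∀ p k → coeff (List.map g p) k ≈ g (coeff p k)
  coeff-map g g0≈0 []      k       = sym g0≈0
  coeff-map g g0≈0 (x ∷ p) zero    = refl
  coeff-map g g0≈0 (x ∷ p) (suc k) = coeff-map g g0≈0 p k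

  coeff-scale : ∀ x p k → coeff (scale x p) k ≈ x * coeff p k
  coeff-scale x = coeff-map (x *_) (zeroʳ x)

  coeff-neg : ∀ p k → coeff (-ₗ p) k ≈ - coeff p k
  coeff-neg = coeff-map (-_) -0#≈0#

  +ₗ-cong : ∀ {p p′ q q′} → p ≋ p′ → q ≋ q′ → p +ₗ q ≋ p′ +ₗ q′
  +ₗ-cong {p} {p′} {q} {q′} e f = coeffwise λ k → begin
    coeff (p +ₗ q) k          ≈⟨ coeff-+ₗ p q k ⟩
    coeff p k + coeff q k     ≈⟨ +-cong (coeff-≈ e k) (coeff-≈ f k) ⟩
    coeff p′ k + coeff q′ k   ≈⟨ coeff-+ₗ p′ q′ k ⟨
    coeff (p′ +ₗ q′) k        ∎
    where open ≈-Reasoning setoid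

  -ₗ-cong : ∀ {p q} → p ≋ q → -ₗ p ≋ -ₗ q
  -ₗ-cong {p} {q} e = coeffwise λ k →
    trans (coeff-neg p k) (trans (-‿cong (coeff-≈ e k)) (sym (coeff-neg q k)))

  scale-cong : ∀ {x y p q} → x ≈ y → p ≋ q → scale x p ≋ scale y q
  scale-cong {x} {y} {p} {q} x≈y e = coeffwise λ k →
    trans (coeff-scale x p k) (trans (*-cong x≈y (coeff-≈ e k)) (sym (coeff-scale y q k)))

  +ₗ-assoc : ∀ p q r → (p +ₗ q) +ₗ r ≋ p +ₗ (q +ₗ r)
  +ₗ-assoc p q r = coeffwise λ k → begin
    coeff ((p +ₗ q) +ₗ r) k                  ≈⟨ trans (coeff-+ₗ (p +ₗ q) r k) (+-congʳ (coeff-+ₗ p q k)) ⟩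
    (coeff p k + coeff q k) + coeff r k      ≈⟨ +-assoc _ _ _ ⟩
    coeff p k + (coeff q k + coeff r k)      ≈⟨ trans (coeff-+ₗ p (q +ₗ r) k) (+-congˡ (coeff-+ₗ q r k)) ⟨
    coeff (p +ₗ (q +ₗ r)) k                  ∎
    where open ≈-Reasoning setoid

  +ₗ-comm : ∀ p q → p +ₗ q ≋ q +ₗ p
  +ₗ-comm p q = coeffwise λ k →
    trans (coeff-+ₗ p q k) (trans (+-comm _ _) (sym (coeff-+ₗ q p k)))

  +ₗ-interchange : ∀ p q r s → (p +ₗ q) +ₗ (r +ₗ s) ≋ (p +ₗ r) +ₗ (q +ₗ s)
  +ₗ-interchange p q r s = coeffwise λ k → begin
    coeff ((p +ₗ q) +ₗ (r +ₗ s)) k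
      ≈⟨ trans (coeff-+ₗ (p +ₗ q) (r +ₗ s) k) (+-cong (coeff-+ₗ p q k) (coeff-+ₗ r s k)) ⟩
    (coeff p k + coeff q k) + (coeff r k + coeff s k)
      ≈⟨ interchange _ _ _ _ ⟩
    (coeff p k + coeff r k) + (coeff q k + coeff s k)
      ≈⟨ trans (coeff-+ₗ (p +ₗ r) (q +ₗ s) k) (+-cong (coeff-+ₗ p r k) (coeff-+ₗ q s k)) ⟨
    coeff ((p +ₗ r) +ₗ (q +ₗ s)) k
      ∎
    where open ≈-Reasoning setoid

  +ₗ-identityʳ : ∀ p → p +ₗ [] ≋ p
  +ₗ-identityʳ []      = ≋.refl
  +ₗ-identityʳ (x ∷ p) = ≋.refl

  -ₗ-inverseʳ : ∀ p → p +ₗ -ₗ p ≋ []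
  -ₗ-inverseʳ p = coeffwise λ k →
    trans (coeff-+ₗ p (-ₗ p) k) (trans (+-congˡ (coeff-neg p k)) (-‿inverseʳ _))

  -ₗ-inverseˡ : ∀ p → -ₗ p +ₗ p ≋ []
  -ₗ-inverseˡ p = ≋.trans (+ₗ-comm (-ₗ p) p) (-ₗ-inverseʳ p)

  scale-+ₗ : ∀ x p q → scale x (p +ₗ q) ≋ scale x p +ₗ scale x q
  scale-+ₗ x p q = coeffwise λ k → begin
    coeff (scale x (p +ₗ q)) k                  ≈⟨ trans (coeff-scale x (p +ₗ q) k) (*-congˡ (coeff-+ₗ p q k)) ⟩
    x * (coeff p k + coeff q k)                 ≈⟨ distribˡ x _ _ ⟩
    x * coeff p k + x * coeff q k               ≈⟨ trans (coeff-+ₗ (scale x p) (scale x q) k)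
                                                        (+-cong (coeff-scale x p k) (coeff-scale x q k)) ⟨
    coeff (scale x p +ₗ scale x q) k            ∎
    where open ≈-Reasoning setoid

  scale-* : ∀ x y p → scale (x * y) p ≋ scale x (scale y p)
  scale-* x y p = coeffwise λ k → begin
    coeff (scale (x * y) p) k      ≈⟨ coeff-scale (x * y) p k ⟩
    (x * y) * coeff p k            ≈⟨ *-assoc x y _ ⟩
    x * (y * coeff p k)            ≈⟨ trans (coeff-scale x (scale y p) k) (*-congˡ (coeff-scale y p k)) ⟨
    coeff (scale x (scale y p)) k  ∎
    where open ≈-Reasoning setoid

  scale-0# : ∀ p → scale 0# p ≋ []
  scale-0# p = coeffwise λ k → trans (coeff-scale 0# p k) (zeroˡ _)

  scale-1# : ∀ p → scale 1# p ≋ p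
  scale-1# p = coeffwise λ k → trans (coeff-scale 1# p k) (*-identityˡ _)

  0∷-+ₗ : ∀ p q → 0# ∷ (p +ₗ q) ≋ (0# ∷ p) +ₗ (0# ∷ q)
  0∷-+ₗ p q = ∷-cong (sym (+-identityˡ 0#)) ≋.refl

  0∷-*ₗ : ∀ p q → (0# ∷ p) *ₗ q ≋ 0# ∷ (p *ₗ q)
  0∷-*ₗ p q = +ₗ-cong (scale-0# q) ≋.refl

  *ₗ-congʳ : ∀ p {q q′} → q ≋ q′ → p *ₗ q ≋ p *ₗ q′
  *ₗ-congʳ []      e = ≋.refl
  *ₗ-congʳ (x ∷ p) e = +ₗ-cong (scale-cong refl e) (∷-cong refl (*ₗ-congʳ p e))

  *ₗ-distribˡ : ∀ p q r → p *ₗ (q +ₗ r) ≋ p *ₗ q +ₗ p *ₗ r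
  *ₗ-distribˡ []      q r = ≋.refl
  *ₗ-distribˡ (x ∷ p) q r = begin
    scale x (q +ₗ r) +ₗ (0# ∷ p *ₗ (q +ₗ r))
      ≈⟨ +ₗ-cong (scale-+ₗ x q r) (≋.trans (∷-cong refl (*ₗ-distribˡ p q r)) (0∷-+ₗ (p *ₗ q) (p *ₗ r))) ⟩
    (scale x q +ₗ scale x r) +ₗ ((0# ∷ p *ₗ q) +ₗ (0# ∷ p *ₗ r))
      ≈⟨ +ₗ-interchange (scale x q) (scale x r) (0# ∷ p *ₗ q) (0# ∷ p *ₗ r) ⟩
    (x ∷ p) *ₗ q +ₗ (x ∷ p) *ₗ r
      ∎
    where open ≋-Reasoning

  *ₗ-zeroʳ : ∀ p → p *ₗ [] ≋ []
  *ₗ-zeroʳ []      = ≋.refl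
  *ₗ-zeroʳ (x ∷ p) = ≋.trans (∷-cong refl (*ₗ-zeroʳ p)) 0∷[]≋[]

  *ₗ-0∷ : ∀ p q → p *ₗ (0# ∷ q) ≋ 0# ∷ (p *ₗ q)
  *ₗ-0∷ []      q = ≋.sym 0∷[]≋[]
  *ₗ-0∷ (x ∷ p) q = ∷-cong (trans (+-identityʳ _) (zeroʳ x)) (+ₗ-cong ≋.refl (*ₗ-0∷ p q))

  *ₗ-constʳ : ∀ p y → p *ₗ (y ∷ []) ≋ scale y p
  *ₗ-constʳ []      y = ≋.refl
  *ₗ-constʳ (x ∷ p) y = ∷-cong (trans (+-identityʳ _) (*-comm x y)) (*ₗ-constʳ p y)

  *ₗ-comm : ∀ p q → p *ₗ q ≋ q *ₗ p
  *ₗ-comm []      q = ≋.sym (*ₗ-zeroʳ q)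
  *ₗ-comm (x ∷ p) q = ≋.sym (begin
    q *ₗ (x ∷ p)                         ≈⟨ *ₗ-congʳ q (∷-cong (sym (+-identityʳ x)) ≋.refl) ⟩
    q *ₗ ((x ∷ []) +ₗ (0# ∷ p))          ≈⟨ *ₗ-distribˡ q (x ∷ []) (0# ∷ p) ⟩
    q *ₗ (x ∷ []) +ₗ q *ₗ (0# ∷ p)       ≈⟨ +ₗ-cong (*ₗ-constʳ q x) (*ₗ-0∷ q p) ⟩
    scale x q +ₗ (0# ∷ q *ₗ p)           ≈⟨ +ₗ-cong ≋.refl (∷-cong refl (*ₗ-comm q p)) ⟩
    (x ∷ p) *ₗ q                         ∎)
    where open ≋-Reasoning

  *ₗ-congˡ : ∀ {p p′} q → p ≋ p′ → p *ₗ q ≋ p′ *ₗ q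
  *ₗ-congˡ {p} {p′} q e = ≋.trans (*ₗ-comm p q) (≋.trans (*ₗ-congʳ q e) (*ₗ-comm q p′))

  *ₗ-distribʳ : ∀ q p p′ → (p +ₗ p′) *ₗ q ≋ p *ₗ q +ₗ p′ *ₗ q
  *ₗ-distribʳ q p p′ = begin
    (p +ₗ p′) *ₗ q        ≈⟨ *ₗ-comm (p +ₗ p′) q ⟩
    q *ₗ (p +ₗ p′)        ≈⟨ *ₗ-distribˡ q p p′ ⟩
    q *ₗ p +ₗ q *ₗ p′     ≈⟨ +ₗ-cong (*ₗ-comm q p) (*ₗ-comm q p′) ⟩
    p *ₗ q +ₗ p′ *ₗ q     ∎
    where open ≋-Reasoning

  scale-*ₗ : ∀ x q r → scale x q *ₗ r ≋ scale x (q *ₗ r)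
  scale-*ₗ x []      r = ≋.refl
  scale-*ₗ x (y ∷ q) r = begin
    scale (x * y) r +ₗ (0# ∷ scale x q *ₗ r)
      ≈⟨ +ₗ-cong (scale-* x y r) (∷-cong (sym (zeroʳ x)) (scale-*ₗ x q r)) ⟩
    scale x (scale y r) +ₗ scale x (0# ∷ q *ₗ r)
      ≈⟨ scale-+ₗ x (scale y r) (0# ∷ q *ₗ r) ⟨
    scale x ((y ∷ q) *ₗ r)
      ∎
    where open ≋-Reasoning

  *ₗ-assoc : ∀ p q r → (p *ₗ q) *ₗ r ≋ p *ₗ (q *ₗ r)
  *ₗ-assoc []      q r = ≋.refl
  *ₗ-assoc (x ∷ p) q r = begin
    (scale x q +ₗ (0# ∷ p *ₗ q)) *ₗ r          ≈⟨ *ₗ-distribʳ r (scale x q) (0# ∷ p *ₗ q) ⟩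
    scale x q *ₗ r +ₗ (0# ∷ p *ₗ q) *ₗ r       ≈⟨ +ₗ-cong (scale-*ₗ x q r)
                                                    (≋.trans (0∷-*ₗ (p *ₗ q) r) (∷-cong refl (*ₗ-assoc p q r))) ⟩
    (x ∷ p) *ₗ (q *ₗ r)                        ∎
    where open ≋-Reasoning

  *ₗ-constˡ : ∀ x p → (x ∷ []) *ₗ p ≋ scale x p
  *ₗ-constˡ x p = ≋.trans (+ₗ-cong ≋.refl 0∷[]≋[]) (+ₗ-identityʳ _)

  *ₗ-identityˡ : ∀ p → (1# ∷ []) *ₗ p ≋ p
  *ₗ-identityˡ p = ≋.trans (*ₗ-constˡ 1# p) (scale-1# p)

  *ₗ-identityʳ : ∀ p → p *ₗ (1# ∷ []) ≋ p
  *ₗ-identityʳ p = ≋.trans (*ₗ-comm p (1# ∷ [])) (*ₗ-identityˡ p)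

  list-isCommutativeRing : IsCommutativeRing _≋_ _+ₗ_ _*ₗ_ -ₗ_ [] (1# ∷ [])
  list-isCommutativeRing = record
    { isRing = record
      { +-isAbelianGroup = record
        { isGroup = record
          { isMonoid = record
            { isSemigroup = record
              { isMagma = record { isEquivalence = ≋-isEquivalence ; ∙-cong = +ₗ-cong }
              ; assoc = +ₗ-assoc }
            ; identity = (λ _ → ≋.refl) , +ₗ-identityʳ }
          ; inverse = -ₗ-inverseˡ , -ₗ-inverseʳ
          ; ⁻¹-cong = -ₗ-cong }
        ; comm = +ₗ-comm }
      ; *-cong = λ {p} {p′} {q} e f → ≋.trans (*ₗ-congˡ q e) (*ₗ-congʳ p′ f)
      ; *-assoc = *ₗ-assoc
      ; *-identity = *ₗ-identityˡ , *ₗ-identityʳ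
      ; distrib = *ₗ-distribˡ , *ₗ-distribʳ }
    ; *-comm = *ₗ-comm }

  ∷ʳ-≈0# : ∀ p {x} → x ≈ 0# → p List.++ x ∷ [] ≋ p
  ∷ʳ-≈0# []      x≈0 = ≋.trans (∷-cong x≈0 ≋.refl) 0∷[]≋[]
  ∷ʳ-≈0# (y ∷ p) x≈0 = ∷-cong refl (∷ʳ-≈0# p x≈0)

  +ₗ-∷ʳ : ∀ p q x y → List.length p ≡ List.length q →
          (p List.++ x ∷ []) +ₗ (q List.++ y ∷ []) ≡ (p +ₗ q) List.++ (x + y) ∷ []
  +ₗ-∷ʳ []      []      x y _  = ≡.refl
  +ₗ-∷ʳ (u ∷ p) (v ∷ q) x y eq = ≡.cong (u + v ∷_) (+ₗ-∷ʳ p q x y (suc-injective eq))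

  replicate-0# : ∀ k → List.replicate k 0# ≋ []
  replicate-0# zero    = ≋.refl
  replicate-0# (suc k) = ≋.trans (∷-cong refl (replicate-0# k)) 0∷[]≋[]

  X*ₗ : ∀ p → (0# ∷ 1# ∷ []) *ₗ p ≋ 0# ∷ p
  X*ₗ p = +ₗ-cong (scale-0# p) (∷-cong refl (*ₗ-identityˡ p))

module RingIdentities {c ℓ} (R : CommutativeRing c ℓ) where
  open CommutativeRing R
  open SemiringSolver commutativeSemiring using (solve; _:=_; _:+_; _:*_)
  open RingProperties ring using (-‿distribʳ-*; -‿+-comm)
  open CommutativeSemigroupProperties *-commutativeSemigroup using (x∙yz≈y∙xz)
  open CommutativeSemigroupProperties +-commutativeSemigroup using (interchange)
  open ≈-Reasoning setoid

  y[u+v]-[l+k]f≈[yu-lf]+[yv-kf] : ∀ y f u v l k → y * (u + v) - (l + k) * f ≈ (y * u - l * f) + (y * v - k * f)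
  y[u+v]-[l+k]f≈[yu-lf]+[yv-kf] y f u v l k = begin
    y * (u + v) - (l + k) * f              ≈⟨ +-cong (distribˡ y u v) (-‿cong (distribʳ f l k)) ⟩
    (y * u + y * v) - (l * f + k * f)      ≈⟨ +-congˡ (-‿+-comm (l * f) (k * f)) ⟨
    (y * u + y * v) + (- (l * f) - k * f)  ≈⟨ interchange (y * u) (y * v) (- (l * f)) (- (k * f)) ⟩
    (y * u - l * f) + (y * v - k * f)      ∎

  y[cu]-[cl]f≈c[yu-lf] : ∀ y f c u l → y * (c * u) - (c * l) * f ≈ c * (y * u - l * f)
  y[cu]-[cl]f≈c[yu-lf] y f c u l = begin
    y * (c * u) - (c * l) * f        ≈⟨ +-cong (x∙yz≈y∙xz y c u) (-‿cong (*-assoc c l f)) ⟩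
    c * (y * u) - c * (l * f)        ≈⟨ +-congˡ (-‿distribʳ-* c (l * f)) ⟩
    c * (y * u) + c * - (l * f)      ≈⟨ distribˡ c (y * u) (- (l * f)) ⟨
    c * (y * u - l * f)              ∎

  c+y[w+fq]+[n+lf]≈c+[yw+n]+f[l+yq] : ∀ c y w f q n l → (c + y * (w + f * q)) + (n + l * f) ≈ (c + (y * w + n)) + f * (l + y * q)
  c+y[w+fq]+[n+lf]≈c+[yw+n]+f[l+yq] = solve 7 (λ c y w f q n l →
    (c :+ y :* (w :+ f :* q)) :+ (n :+ l :* f) := (c :+ (y :* w :+ n)) :+ f :* (l :+ y :* q)) refl

  x+y≈u+v⇒x-v≈u-y : ∀ x y u v → x + y ≈ u + v → x - v ≈ u - y
  x+y≈u+v⇒x-v≈u-y x y u v x+y≈u+v = begin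
    x - v                  ≈⟨ +-congʳ (+-identityʳ x) ⟨
    (x + 0#) - v           ≈⟨ +-congʳ (+-congˡ (-‿inverseʳ y)) ⟨
    (x + (y - y)) - v      ≈⟨ +-congʳ (+-assoc x y (- y)) ⟨
    ((x + y) - y) - v      ≈⟨ +-congʳ (+-congʳ x+y≈u+v) ⟩
    ((u + v) - y) - v      ≈⟨ solve 4 (λ u v y′ v′ → ((u :+ v) :+ y′) :+ v′ := (u :+ y′) :+ (v :+ v′))
                                      refl u v (- y) (- v) ⟩
    (u - y) + (v - v)      ≈⟨ +-congˡ (-‿inverseʳ v) ⟩
    (u - y) + 0#           ≈⟨ +-identityʳ (u - y) ⟩
    u - y                  ∎

  ao+[b[xo-f]+fr]≈[a+xb]o+f[r-b] : ∀ a o b x f r → a * o + (b * (x * o - f) + f * r) ≈ (a + x * b) * o + f * (r - b)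
  ao+[b[xo-f]+fr]≈[a+xb]o+f[r-b] a o b x f r = begin
    a * o + (b * (x * o - f) + f * r)          ≈⟨ +-congˡ (+-congʳ (distribˡ b (x * o) (- f))) ⟩
    a * o + ((b * (x * o) + b * - f) + f * r)  ≈⟨ +-congˡ (+-congʳ (+-congˡ b[-f]≈f[-b])) ⟩
    a * o + ((b * (x * o) + f * - b) + f * r)  ≈⟨ solve 7 (λ a o b x f b′ r → a :* o :+ ((b :* (x :* o) :+ f :* b′) :+ f :* r)
                                                           := (a :+ x :* b) :* o :+ f :* (r :+ b′)) refl a o b x f (- b) r ⟩
    (a + x * b) * o + f * (r - b)              ∎
    where
    b[-f]≈f[-b] : b * - f ≈ f * - b
    b[-f]≈f[-b] = trans (sym (-‿distribʳ-* b f)) (trans (-‿cong (*-comm b f)) (-‿distribʳ-* f b))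


isRingHomomorphism : ∀ {a b ℓ₁ ℓ₂} {R₁ : RawRing a ℓ₁} {R₂ : RawRing b ℓ₂} →
  let module R₁ = RawRing R₁; module R₂ = RawRing R₂ in
  {⟦_⟧ : R₁.Carrier → R₂.Carrier} →
  (∀ {x y} → x R₁.≈ y → ⟦ x ⟧ R₂.≈ ⟦ y ⟧) →
  (∀ x y → ⟦ x R₁.+ y ⟧ R₂.≈ ⟦ x ⟧ R₂.+ ⟦ y ⟧) →
  (∀ x y → ⟦ x R₁.* y ⟧ R₂.≈ ⟦ x ⟧ R₂.* ⟦ y ⟧) →
  (∀ x → ⟦ R₁.- x ⟧ R₂.≈ R₂.- ⟦ x ⟧) → ⟦ R₁.0# ⟧ R₂.≈ R₂.0# → ⟦ R₁.1# ⟧ R₂.≈ R₂.1# →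
  IsRingHomomorphism R₁ R₂ ⟦_⟧
isRingHomomorphism cong +-homo *-homo -‿homo 0#-homo 1#-homo = record
  { isSemiringHomomorphism = record
    { isNearSemiringHomomorphism = record
      { +-isMonoidHomomorphism = record
        { isMagmaHomomorphism = record
          { isRelHomomorphism = record { cong = cong } ; homo = +-homo }
        ; ε-homo = 0#-homo }
      ; *-homo = *-homo }
    ; 1#-homo = 1#-homo }
  ; -‿homo = -‿homo }


toList-init-last : ∀ {a} {A : Set a} {k} (v : Vec A (suc k)) →
                   Vec.toList v ≡ Vec.toList (Vec.init v) ++ Vec.last v ∷ []
toList-init-last v =
  ≡.trans (≡.cong Vec.toList (proj₂ (proj₂ (Vec.initLast v)))) (Vec.toList-∷ʳ (Vec.last v) (Vec.init v))

module _ {a} {A : Set a} (z : A) where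

  coeffL-≥length : ∀ xs {k} → List.length xs ≤ k → coeffL z xs k ≡ z
  coeffL-≥length []       _         = ≡.refl
  coeffL-≥length (x ∷ xs) (s≤s len≤k) = coeffL-≥length xs len≤k

  coeffL-∷ʳ-length : ∀ xs y → coeffL z (xs ++ y ∷ []) (List.length xs) ≡ y
  coeffL-∷ʳ-length []       y = ≡.refl
  coeffL-∷ʳ-length (x ∷ xs) y = coeffL-∷ʳ-length xs y

  coeffL-last : ∀ {k} (v : Vec A (suc k)) → coeffL z (Vec.toList v) k ≡ Vec.last v
  coeffL-last {k} v = ≡.trans (≡.cong (λ l → coeffL z l k) (toList-init-last v))
    (≡.subst (λ i → coeffL z (Vec.toList (Vec.init v) ++ Vec.last v ∷ []) i ≡ Vec.last v)
             (Vec.length-toList (Vec.init v)) (coeffL-∷ʳ-length (Vec.toList (Vec.init v)) (Vec.last v)))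

  coeffL-applyUpTo : ∀ f {N j} → j < N → coeffL z (applyUpTo f N) j ≡ f j
  coeffL-applyUpTo f {suc N} {zero}  _         = ≡.refl
  coeffL-applyUpTo f {suc N} {suc j} (s≤s j<N) = coeffL-applyUpTo (λ i → f (suc i)) j<N

module WeilOperatorProperties {c ℓ} (R : CommutativeRing c ℓ) {m : ℕ}
  (a : Vec (CommutativeRing.Carrier R) (suc m)) where

  open import Data.Nat.Base using (_+_)
  open import Data.Nat.Properties
    using ( ≡⇒≡ᵇ; ≡ᵇ⇒≡; _<?_; _≟_; ≮⇒≥; <⇒≤; <⇒≢; ≤∧≢⇒<; ≤-pred; ≤-refl; ≤-reflexive
          ; ≤-trans; n≤1+n; n<1+n; m<n⇒m<1+n; m≤m+n; m≤n+m; m≤n+m∸n; +-monoˡ-≤; +-monoʳ-≤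
          ; +-comm; +-suc; +-identityʳ )
  open Weil R a
  private module K = CommutativeRing R

  negP : ∀ {r} → MPoly r → MPoly r
  negP {r} = Ops.neg (ops r)

  -- _≈P_ is defined by cases on both polynomials, so it is wrapped in a
  -- record to keep the polynomials (and the number of variables) inferable.
  infix 4 _≃_
  record _≃_ {r} (x y : MPoly r) : Set ℓ where
    constructor ⟨_⟩
    field ≃⇒≈P : x ≈P y
  open _≃_ public

  mpoly-isCommutativeRing : ∀ r → IsCommutativeRing (_≃_ {r}) _+P_ _*P_ negP pzero pone

  module Coefficients (r : ℕ) = CoefficientList (ops r) _≃_ (mpoly-isCommutativeRing r)

  mpoly-isCommutativeRing zero = RingMonomorphism.isCommutativeRing
    (record
      { isRingHomomorphism = isRingHomomorphism {R₂ = CommutativeRing.rawRing R} {unCst}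
          (λ { {cst x} {cst y} x≃y → ≃⇒≈P x≃y })
          (λ { (cst x) (cst y) → K.refl }) (λ { (cst x) (cst y) → K.refl })
          (λ { (cst x) → K.refl }) K.refl K.refl
      ; injective = λ { {cst x} {cst y} x≈y → ⟨ x≈y ⟩ } })
    K.isCommutativeRing
    where
    unCst : MPoly zero → K.Carrier
    unCst (cst x) = x
  mpoly-isCommutativeRing (suc r) = RingMonomorphism.isCommutativeRing
    (record
      { isRingHomomorphism = isRingHomomorphism {R₂ = listRawRing} {unpol}
          (λ { {pol p} {pol q} p≃q → coeffwise λ k → ⟨ ≃⇒≈P p≃q k ⟩ })
          (λ _ _ → ≋.refl) (λ _ _ → ≋.refl) (λ _ → ≋.refl) ≋.refl ≋.refl
      ; injective = λ { {pol p} {pol q} p≋q → ⟨ (λ k → ≃⇒≈P (coeff-≈ p≋q k)) ⟩ } })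
    list-isCommutativeRing
    where
    open Coefficients r
    listRawRing : RawRing c ℓ
    listRawRing = record
      { _≈_ = _≋_ ; _+_ = _+ₗ_ ; _*_ = _*ₗ_ ; -_ = -ₗ_ ; 0# = [] ; 1# = pone ∷ [] }

  MPolyRing : ℕ → CommutativeRing c ℓ
  MPolyRing r = record { isCommutativeRing = mpoly-isCommutativeRing r }

  coefficients : List K.Carrier
  coefficients = Vec.toList a ++ K.1# ∷ []

  private
    length-coefficients : List.length coefficients ≡ n + 1
    length-coefficients =
      ≡.trans (List.length-++ (Vec.toList a)) (≡.cong (_+ 1) (Vec.length-toList a))

  coef-n : coef n ≡ K.1#
  coef-n = ≡.subst (λ k → coeffL K.0# coefficients k ≡ K.1#)
    (Vec.length-toList a) (coeffL-∷ʳ-length K.0# (Vec.toList a) K.1#)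

  coef-beyond : ∀ {i} → n ≤ i → coef (i + 1) ≡ K.0#
  coef-beyond n≤i = coeffL-≥length K.0# coefficients
    (≡.subst (_≤ _) (≡.sym length-coefficients) (+-monoˡ-≤ 1 n≤i))

  coeffL-D : ∀ k j → coeffL K.0# (D k) j ≡ coef (k + j + 1)
  coeffL-D k j with j <? n ∸ k
  ... | yes j<n∸k = ≡.trans
    (≡.cong (λ l → coeffL K.0# l j) (List.map-upTo (λ i → coef (k + i + 1)) (n ∸ k)))
    (coeffL-applyUpTo K.0# (λ i → coef (k + i + 1)) j<n∸k)
  ... | no  j≮n∸k = ≡.trans
    (coeffL-≥length K.0# (D k) (≡.subst (_≤ j) (≡.sym length-D) (≮⇒≥ j≮n∸k)))
    (≡.sym (coef-beyond (≤-trans (m≤n+m∸n n k) (+-monoʳ-≤ k (≮⇒≥ j≮n∸k)))))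
    where
    length-D : List.length (D k) ≡ n ∸ k
    length-D = ≡.trans (List.length-map _ (upTo (n ∸ k))) (List.length-applyUpTo (λ i → i) (n ∸ k))

  module Outer (r : ℕ) where
    module C = CommutativeRing (MPolyRing r)
    module P = CommutativeRing (MPolyRing (suc r))
    module L = Coefficients r
    open CommutativeSemigroupProperties P.*-commutativeSemigroup using (x∙yz≈y∙xz)

    Y : MPoly (suc r)
    Y = pol (pzero ∷ pone ∷ [])

    pol-cong : ∀ {p q} → p L.≋ q → pol p ≃ pol q
    pol-cong p≋q = ⟨ (λ k → ≃⇒≈P (L.coeff-≈ p≋q k)) ⟩

    coeffOuter-cong : ∀ {x y : MPoly (suc r)} → x ≃ y → ∀ j → coeffOuter x j ≃ coeffOuter y j
    coeffOuter-cong {pol p} {pol q} x≃y j = ⟨ ≃⇒≈P x≃y j ⟩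

    coeffOuter-ext : ∀ {x y : MPoly (suc r)} → (∀ j → coeffOuter x j ≃ coeffOuter y j) → x ≃ y
    coeffOuter-ext {pol p} {pol q} eq = ⟨ (λ j → ≃⇒≈P (eq j)) ⟩

    unpol-cong : ∀ {x y : MPoly (suc r)} → x ≃ y → unpol x L.≋ unpol y
    unpol-cong {pol p} {pol q} x≃y = L.coeffwise λ k → ⟨ ≃⇒≈P x≃y k ⟩

    coeffOuter-+ : ∀ (x y : MPoly (suc r)) j → coeffOuter (x +P y) j ≃ coeffOuter x j +P coeffOuter y j
    coeffOuter-+ (pol p) (pol q) = L.coeff-+ₗ p q

    coeffOuter-neg : ∀ (x : MPoly (suc r)) j → coeffOuter (negP x) j ≃ negP (coeffOuter x j)
    coeffOuter-neg (pol p) = L.coeff-neg p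

    coeffOuter-lift* : ∀ c (x : MPoly (suc r)) j → coeffOuter (lift c *P x) j ≃ c *P coeffOuter x j
    coeffOuter-lift* c (pol p) j = C.trans (L.coeff-≈ (L.*ₗ-constˡ c p) j) (L.coeff-scale c p j)

    Y*-pol : ∀ p → Y *P pol p ≃ pol (pzero ∷ p)
    Y*-pol p = pol-cong (L.X*ₗ p)

    coeffOuter-Y*-zero : ∀ (x : MPoly (suc r)) → coeffOuter (Y *P x) 0 ≃ pzero
    coeffOuter-Y*-zero (pol p) = coeffOuter-cong (Y*-pol p) 0

    coeffOuter-Y*-suc : ∀ (x : MPoly (suc r)) j → coeffOuter (Y *P x) (suc j) ≃ coeffOuter x j
    coeffOuter-Y*-suc (pol p) j = coeffOuter-cong (Y*-pol p) (suc j)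

    pol-∷ : ∀ c p → pol (c ∷ p) ≃ lift c +P Y *P pol p
    pol-∷ c p = P.sym (P.trans (P.+-congˡ {lift c} (Y*-pol p)) (pol-cong (L.∷-cong (C.+-identityʳ c) L.≋.refl)))

    lift-cong : ∀ {x y : MPoly r} → x ≃ y → lift x ≃ lift y
    lift-cong x≃y = pol-cong (L.∷-cong x≃y L.≋.refl)

    lift-0 : lift pzero ≃ pzero
    lift-0 = pol-cong L.0∷[]≋[]

    lift-* : ∀ (x y : MPoly r) → lift (x *P y) ≃ lift x *P lift y
    lift-* x y = pol-cong (L.∷-cong (C.sym (C.+-identityʳ _)) L.≋.refl)

    coeffOuter-monomial-same : ∀ c k → coeffOuter (lift c *P pow Y k) k ≃ c
    coeffOuter-monomial-same c zero    = coeffOuter-cong (P.*-identityʳ (lift c)) 0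
    coeffOuter-monomial-same c (suc k) = C.trans
      (coeffOuter-cong (x∙yz≈y∙xz (lift c) Y (pow Y k)) (suc k))
      (C.trans (coeffOuter-Y*-suc (lift c *P pow Y k) k) (coeffOuter-monomial-same c k))

    coeffOuter-monomial-other : ∀ c k j → ¬ j ≡ k → coeffOuter (lift c *P pow Y k) j ≃ pzero
    coeffOuter-monomial-other c zero    zero    j≢k = ⊥-elim (j≢k ≡.refl)
    coeffOuter-monomial-other c zero    (suc j) _   = coeffOuter-cong (P.*-identityʳ (lift c)) (suc j)
    coeffOuter-monomial-other c (suc k) zero    _   = C.trans
      (coeffOuter-cong (x∙yz≈y∙xz (lift c) Y (pow Y k)) 0) (coeffOuter-Y*-zero (lift c *P pow Y k))
    coeffOuter-monomial-other c (suc k) (suc j) j≢k = C.trans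
      (coeffOuter-cong (x∙yz≈y∙xz (lift c) Y (pow Y k)) (suc j))
      (C.trans (coeffOuter-Y*-suc (lift c *P pow Y k) j)
               (coeffOuter-monomial-other c k j (λ j≡k → j≢k (≡.cong suc j≡k))))

    coeffOuter-sumTo : ∀ N (f : ℕ → MPoly (suc r)) j →
                       coeffOuter (sumTo N f) j ≃ sumTo N (λ k → coeffOuter (f k) j)
    coeffOuter-sumTo zero    f j = C.refl
    coeffOuter-sumTo (suc N) f j =
      C.trans (coeffOuter-+ (sumTo N f) (f N) j) (C.+-congʳ (coeffOuter-sumTo N f j))

    monomials : ℕ → (ℕ → MPoly r) → MPoly (suc r)
    monomials N g = sumTo N (λ k → lift (g k) *P pow Y k)

    coeffOuter-monomials-≥ : ∀ N g {j} → N ≤ j → coeffOuter (monomials N g) j ≃ pzero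
    coeffOuter-monomials-≥ zero    g N≤j = C.refl
    coeffOuter-monomials-≥ (suc N) g {j} N<j = C.trans
      (coeffOuter-+ (monomials N g) (lift (g N) *P pow Y N) j)
      (C.trans (C.+-cong (coeffOuter-monomials-≥ N g (<⇒≤ N<j))
                         (coeffOuter-monomial-other (g N) N j (λ j≡N → <⇒≢ N<j (≡.sym j≡N))))
               (C.+-identityˡ pzero))

    coeffOuter-monomials-< : ∀ N g {j} → j < N → coeffOuter (monomials N g) j ≃ g j
    coeffOuter-monomials-< (suc N) g {j} j<N+1 with j ≟ N
    ... | yes ≡.refl = C.trans (coeffOuter-+ (monomials N g) (lift (g N) *P pow Y N) N)
      (C.trans (C.+-cong (coeffOuter-monomials-≥ N g ≤-refl) (coeffOuter-monomial-same (g N) N))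
               (C.+-identityˡ (g N)))
    ... | no  j≢N = C.trans (coeffOuter-+ (monomials N g) (lift (g N) *P pow Y N) j)
      (C.trans (C.+-cong (coeffOuter-monomials-< N g (≤∧≢⇒< (≤-pred j<N+1) j≢N))
                         (coeffOuter-monomial-other (g N) N j j≢N))
               (C.+-identityʳ (g j)))

    Bounded : MPoly (suc r) → Set ℓ
    Bounded x = ∀ k → n ≤ k → coeffOuter x k ≃ pzero

    lift-bounded : ∀ c → Bounded (lift c)
    lift-bounded c (suc k) _ = C.refl

    ≃-monomials : ∀ x g → Bounded x → (∀ j → j < n → coeffOuter x j ≃ g j) → x ≃ monomials n g
    ≃-monomials x g bounded coeff≃g = coeffOuter-ext λ j → case j <? n of λ where
      (yes j<n) → C.trans (coeff≃g j j<n) (C.sym (coeffOuter-monomials-< n g j<n))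
      (no  j≮n) → C.trans (bounded j (≮⇒≥ j≮n)) (C.sym (coeffOuter-monomials-≥ n g (≮⇒≥ j≮n)))

    ≃-lift+Y* : ∀ {x} c y → coeffOuter x 0 ≃ c → (∀ i → coeffOuter x (suc i) ≃ coeffOuter y i) →
                x ≃ lift c +P Y *P y
    ≃-lift+Y* c y eq₀ eqₛ = coeffOuter-ext λ where
      zero    → C.trans eq₀ (C.sym (C.trans (coeffOuter-+ (lift c) (Y *P y) 0)
                  (C.trans (C.+-congˡ (coeffOuter-Y*-zero y)) (C.+-identityʳ c))))
      (suc i) → C.trans (eqₛ i) (C.sym (C.trans (coeffOuter-+ (lift c) (Y *P y) (suc i))
                  (C.trans (C.+-identityˡ _) (coeffOuter-Y*-suc y i))))

  embed-0# : ∀ r → embed r K.0# ≃ pzero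
  embed-0# zero    = ⟨ K.refl ⟩
  embed-0# (suc r) = P.trans (lift-cong (embed-0# r)) lift-0
    where open Outer r

  embed-1# : ∀ r → embed r K.1# ≃ pone
  embed-1# zero    = ⟨ K.refl ⟩
  embed-1# (suc r) = Outer.lift-cong r (embed-1# r)

  module Monic (r : ℕ) where
    open Outer r

    fY : MPoly (suc r)
    fY = pol (List.map (embed r) coefficients)

    δ : ℕ → MPoly (suc r)
    δ k = eval (D k) Y

    coeffOuter-fY : ∀ i → coeffOuter fY i ≃ embed r (coef i)
    coeffOuter-fY = go coefficients
      where
      go : ∀ cs i → coeffL pzero (List.map (embed r) cs) i ≃ embed r (coeffL K.0# cs i)
      go []       i       = C.sym (embed-0# r)
      go (x ∷ cs) zero    = C.refl
      go (x ∷ cs) (suc i) = go cs i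

    coeffOuter-eval-Y : ∀ g i → coeffOuter (eval g Y) i ≃ embed r (coeffL K.0# g i)
    coeffOuter-eval-Y []      i       = C.sym (embed-0# r)
    coeffOuter-eval-Y (x ∷ g) zero    = C.trans (coeffOuter-+ (lift (embed r x)) (Y *P eval g Y) 0)
      (C.trans (C.+-congˡ (coeffOuter-Y*-zero (eval g Y))) (C.+-identityʳ (embed r x)))
    coeffOuter-eval-Y (x ∷ g) (suc i) = C.trans (coeffOuter-+ (lift (embed r x)) (Y *P eval g Y) (suc i))
      (C.trans (C.+-identityˡ _) (C.trans (coeffOuter-Y*-suc (eval g Y) i) (coeffOuter-eval-Y g i)))

    coeffOuter-δ : ∀ k i → coeffOuter (δ k) i ≃ embed r (coef (k + i + 1))
    coeffOuter-δ k i = C.trans (coeffOuter-eval-Y (D k) i) (C.reflexive (≡.cong (embed r) (coeffL-D k i)))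

    coeffOuter-δ-beyond : ∀ k i → n ≤ k + i → coeffOuter (δ k) i ≃ pzero
    coeffOuter-δ-beyond k i n≤k+i = C.trans (coeffOuter-δ k i)
      (C.trans (C.reflexive (≡.cong (embed r) (coef-beyond n≤k+i))) (embed-0# r))

    δ-bounded : ∀ k → Bounded (δ k)
    δ-bounded k i n≤i = coeffOuter-δ-beyond k i (≤-trans n≤i (m≤n+m i k))

    δ-vanishes : ∀ {k} → n ≤ k → δ k ≃ pzero
    δ-vanishes {k} n≤k = coeffOuter-ext λ i → coeffOuter-δ-beyond k i (≤-trans n≤k (m≤m+n k i))

    δ-last : δ m ≃ pone
    δ-last = coeffOuter-ext λ where
      zero    → C.trans (coeffOuter-δ m 0) (C.trans
                  (C.reflexive (≡.cong (λ i → embed r (coef i)) (≡.trans (≡.cong (_+ 1) (+-identityʳ m)) (+-comm m 1))))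
                  (C.trans (C.reflexive (≡.cong (embed r) coef-n)) (embed-1# r)))
      (suc i) → coeffOuter-δ-beyond m (suc i) (≤-trans (s≤s (m≤m+n m i)) (≤-reflexive (≡.sym (+-suc m i))))

    δ-step : ∀ k → δ k ≃ lift (embed r (coef (suc k))) +P Y *P δ (suc k)
    δ-step k = ≃-lift+Y* _ (δ (suc k))
      (C.trans (coeffOuter-δ k 0) (C.reflexive (≡.cong (λ i → embed r (coef i))
        (≡.trans (≡.cong (_+ 1) (+-identityʳ k)) (+-comm k 1)))))
      (λ i → C.trans (coeffOuter-δ k (suc i)) (C.trans
        (C.reflexive (≡.cong (λ j → embed r (coef (j + 1))) (+-suc k i)))
        (C.sym (coeffOuter-δ (suc k) i))))

    fY-δ : fY ≃ lift (embed r (coef 0)) +P Y *P δ 0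
    fY-δ = ≃-lift+Y* _ (δ 0) (coeffOuter-fY 0)
      (λ i → C.trans (coeffOuter-fY (suc i)) (C.trans
        (C.reflexive (≡.cong (λ j → embed r (coef j)) (+-comm 1 i)))
        (C.sym (coeffOuter-δ 0 i))))

  module Remainder (r : ℕ) where
    open Outer r
    open Monic r
    open RingIdentities (MPolyRing (suc r))
    open CommutativeSemigroupProperties P.+-commutativeSemigroup using () renaming (interchange to +-interchange)
    open CommutativeSemigroupProperties P.*-commutativeSemigroup using (x∙yz≈y∙xz)
    open RingProperties P.ring using (-0#≈0#)

    lead : MPoly (suc r) → MPoly r
    lead x = coeffOuter x m

    shiftReduce : MPoly (suc r) → MPoly (suc r)
    shiftReduce w = Y *P w +P negP (lift (lead w) *P fY)

    private
      e = embed r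

      toList-zipWith : ∀ {k} (us : Vec (MPoly r) k) (αs : Vec K.Carrier k) y →
        Vec.toList (Vec.zipWith (λ u α → u +P negP (y *P e α)) us αs)
          ≡ Vec.toList us L.+ₗ List.map (λ α → negP (y *P e α)) (Vec.toList αs)
      toList-zipWith Vec.[]       Vec.[]       y = ≡.refl
      toList-zipWith (u Vec.∷ us) (α Vec.∷ αs) y = ≡.cong (_ ∷_) (toList-zipWith us αs y)

    toList-shiftRed : ∀ v → Vec.toList (shiftRed (ops r) e v) L.≋ unpol (shiftReduce (pol (Vec.toList v)))
    toList-shiftRed v = begin
      Vec.toList (Vec.zipWith (λ u α → u +P g α) (pzero Vec.∷ us) a)
        ≡⟨ toList-zipWith (pzero Vec.∷ us) a y ⟩
      (pzero ∷ Vec.toList us) L.+ₗ List.map g (Vec.toList a)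
        ≈⟨ L.∷ʳ-≈0# _ y+g1≃0 ⟨
      ((pzero ∷ Vec.toList us) L.+ₗ List.map g (Vec.toList a)) ++ (y +P g K.1#) ∷ []
        ≡⟨ L.+ₗ-∷ʳ (pzero ∷ Vec.toList us) (List.map g (Vec.toList a)) y (g K.1#) same-length ⟨
      (pzero ∷ Vec.toList us ++ y ∷ []) L.+ₗ (List.map g (Vec.toList a) ++ g K.1# ∷ [])
        ≡⟨ ≡.cong₂ (λ l h → (pzero ∷ l) L.+ₗ h)
                   (≡.sym (toList-init-last v)) (≡.sym (List.map-++ g (Vec.toList a) (K.1# ∷ []))) ⟩
      (pzero ∷ Vec.toList v) L.+ₗ List.map g coefficients
        ≡⟨ ≡.cong ((pzero ∷ Vec.toList v) L.+ₗ_)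
                  (≡.trans (List.map-∘ coefficients) (≡.cong L.-ₗ_ (List.map-∘ coefficients))) ⟩
      (pzero ∷ Vec.toList v) L.+ₗ L.-ₗ L.scale y (List.map e coefficients)
        ≈⟨ L.+ₗ-cong (L.X*ₗ (Vec.toList v)) (L.-ₗ-cong (L.*ₗ-constˡ y (List.map e coefficients))) ⟨
      unpol (Y *P pol (Vec.toList v) +P negP (lift y *P fY))
        ≡⟨ ≡.cong (λ z → unpol (Y *P pol (Vec.toList v) +P negP (lift z *P fY))) (coeffL-last pzero v) ⟨
      unpol (shiftReduce (pol (Vec.toList v)))
        ∎
      where
      open L.≋-Reasoning
      us = Vec.init v
      y = Vec.last v
      g : K.Carrier → MPoly r
      g α = negP (y *P e α)
      y+g1≃0 : y +P g K.1# ≃ pzero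
      y+g1≃0 = C.trans (C.+-congˡ (C.-‿cong (C.trans (C.*-congˡ (embed-1# r)) (C.*-identityʳ y))))
                       (C.-‿inverseʳ y)
      same-length : List.length (pzero ∷ Vec.toList us) ≡ List.length (List.map g (Vec.toList a))
      same-length = ≡.trans (≡.cong suc (Vec.length-toList us))
        (≡.sym (≡.trans (List.length-map g (Vec.toList a)) (Vec.length-toList a)))

    reduceOuter-[] : reduceOuter (pol []) ≃ pzero
    reduceOuter-[] = pol-cong (L.≋.trans (L.≋.reflexive (Vec.toList-replicate n pzero)) (L.replicate-0# n))

    reduceOuter-∷ : ∀ c p → reduceOuter (pol (c ∷ p)) ≃ lift c +P shiftReduce (reduceOuter (pol p))
    reduceOuter-∷ c p = pol-cong (L.≋.trans (toList-addHead (shiftRed (ops r) e (remV (ops r) e p)))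
                                            (L.+ₗ-cong L.≋.refl (toList-shiftRed (remV (ops r) e p))))
      where
      toList-addHead : ∀ (v : Vec (MPoly r) n) → Vec.toList (addHead (ops r) e c v) L.≋ (c ∷ []) L.+ₗ Vec.toList v
      toList-addHead (y Vec.∷ ys) = L.≋.refl

    shiftReduce-cong : ∀ {w w′} → w ≃ w′ → shiftReduce w ≃ shiftReduce w′
    shiftReduce-cong w≃w′ =
      P.+-cong (P.*-congˡ {Y} w≃w′) (P.-‿cong (P.*-congʳ {fY} (lift-cong (coeffOuter-cong w≃w′ m))))

    shiftReduce-+ : ∀ w w′ → shiftReduce (w +P w′) ≃ shiftReduce w +P shiftReduce w′
    shiftReduce-+ w w′ = begin
      Y *P (w +P w′) +P negP (lift (lead (w +P w′)) *P fY)
        ≈⟨ P.+-congˡ {Y *P (w +P w′)} (P.-‿cong (P.*-congʳ {fY} (lift-cong (coeffOuter-+ w w′ m)))) ⟩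
      Y *P (w +P w′) +P negP ((lift (lead w) +P lift (lead w′)) *P fY)
        ≈⟨ y[u+v]-[l+k]f≈[yu-lf]+[yv-kf] Y fY w w′ (lift (lead w)) (lift (lead w′)) ⟩
      shiftReduce w +P shiftReduce w′
        ∎
      where open ≈-Reasoning P.setoid

    shiftReduce-lift* : ∀ c w → shiftReduce (lift c *P w) ≃ lift c *P shiftReduce w
    shiftReduce-lift* c w = begin
      Y *P (lift c *P w) +P negP (lift (lead (lift c *P w)) *P fY)
        ≈⟨ P.+-congˡ {Y *P (lift c *P w)} (P.-‿cong (P.*-congʳ {fY}
             (P.trans (lift-cong (coeffOuter-lift* c w m)) (lift-* c (lead w))))) ⟩
      Y *P (lift c *P w) +P negP ((lift c *P lift (lead w)) *P fY)
        ≈⟨ y[cu]-[cl]f≈c[yu-lf] Y fY (lift c) w (lift (lead w)) ⟩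
      lift c *P shiftReduce w
        ∎
      where open ≈-Reasoning P.setoid

    shiftReduce-0 : shiftReduce pzero ≃ pzero
    shiftReduce-0 = begin
      shiftReduce pzero                     ≈⟨ shiftReduce-cong (P.sym (P.zeroʳ (lift pzero))) ⟩
      shiftReduce (lift pzero *P pzero)     ≈⟨ shiftReduce-lift* pzero pzero ⟩
      lift pzero *P shiftReduce pzero       ≈⟨ P.trans (P.*-congʳ {shiftReduce pzero} lift-0) (P.zeroˡ (shiftReduce pzero)) ⟩
      pzero                                 ∎
      where open ≈-Reasoning P.setoid

    shiftReduce-lead≃0 : ∀ w → lead w ≃ pzero → shiftReduce w ≃ Y *P w
    shiftReduce-lead≃0 w lead≃0 = P.trans
      (P.+-congˡ {Y *P w} (P.trans (P.-‿cong (P.trans (P.*-congʳ {fY} (P.trans (lift-cong lead≃0) lift-0)) (P.zeroˡ fY))) -0#≈0#))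
      (P.+-identityʳ (Y *P w))

    reduceOuter-≋[] : ∀ p → p L.≋ [] → reduceOuter (pol p) ≃ pzero
    reduceOuter-≋[] []      _     = reduceOuter-[]
    reduceOuter-≋[] (c ∷ p) p≋[] = begin
      reduceOuter (pol (c ∷ p))                   ≈⟨ reduceOuter-∷ c p ⟩
      lift c +P shiftReduce (reduceOuter (pol p)) ≈⟨ P.+-cong (P.trans (lift-cong c≃0) lift-0)
                                                        (shiftReduce-cong (reduceOuter-≋[] p tail≋[])) ⟩
      pzero +P shiftReduce pzero                  ≈⟨ P.trans (P.+-identityˡ _) shiftReduce-0 ⟩
      pzero                                       ∎
      where
      open ≈-Reasoning P.setoid
      c≃0 = proj₁ (L.∷-injective (L.≋.trans p≋[] (L.≋.sym L.0∷[]≋[])))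
      tail≋[] = proj₂ (L.∷-injective (L.≋.trans p≋[] (L.≋.sym L.0∷[]≋[])))

    reduceOuter-cong : ∀ {x y : MPoly (suc r)} → x ≃ y → reduceOuter x ≃ reduceOuter y
    reduceOuter-cong {pol p} {pol q} x≃y = go p q (unpol-cong x≃y)
      where
      go : ∀ p q → p L.≋ q → reduceOuter (pol p) ≃ reduceOuter (pol q)
      go []      []      _   = P.refl
      go (c ∷ p) []      p≋q = P.trans (reduceOuter-≋[] (c ∷ p) p≋q) (P.sym reduceOuter-[])
      go []      (d ∷ q) p≋q = P.trans reduceOuter-[] (P.sym (reduceOuter-≋[] (d ∷ q) (L.≋.sym p≋q)))
      go (c ∷ p) (d ∷ q) p≋q = P.trans (reduceOuter-∷ c p) (P.trans
        (P.+-cong (lift-cong (proj₁ (L.∷-injective p≋q))) (shiftReduce-cong (go p q (proj₂ (L.∷-injective p≋q)))))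
        (P.sym (reduceOuter-∷ d q)))

    reduceOuter-+ : ∀ (x y : MPoly (suc r)) → reduceOuter (x +P y) ≃ reduceOuter x +P reduceOuter y
    reduceOuter-+ (pol p) (pol q) = go p q
      where
      go : ∀ p q → reduceOuter (pol (p L.+ₗ q)) ≃ reduceOuter (pol p) +P reduceOuter (pol q)
      go []      q       = P.sym (P.trans (P.+-congʳ {reduceOuter (pol q)} reduceOuter-[]) (P.+-identityˡ _))
      go (c ∷ p) []      = P.sym (P.trans (P.+-congˡ {reduceOuter (pol (c ∷ p))} reduceOuter-[]) (P.+-identityʳ _))
      go (c ∷ p) (d ∷ q) = begin
        reduceOuter (pol (c +P d ∷ p L.+ₗ q))
          ≈⟨ reduceOuter-∷ (c +P d) (p L.+ₗ q) ⟩
        lift (c +P d) +P shiftReduce (reduceOuter (pol (p L.+ₗ q)))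
          ≈⟨ P.+-congˡ {lift (c +P d)} (P.trans (shiftReduce-cong (go p q))
                                                (shiftReduce-+ (reduceOuter (pol p)) (reduceOuter (pol q)))) ⟩
        (lift c +P lift d) +P (shiftReduce (reduceOuter (pol p)) +P shiftReduce (reduceOuter (pol q)))
          ≈⟨ +-interchange (lift c) (lift d) (shiftReduce (reduceOuter (pol p))) (shiftReduce (reduceOuter (pol q))) ⟩
        (lift c +P shiftReduce (reduceOuter (pol p))) +P (lift d +P shiftReduce (reduceOuter (pol q)))
          ≈⟨ P.+-cong (reduceOuter-∷ c p) (reduceOuter-∷ d q) ⟨
        reduceOuter (pol (c ∷ p)) +P reduceOuter (pol (d ∷ q))
          ∎
        where open ≈-Reasoning P.setoid

    reduceOuter-lift* : ∀ c (x : MPoly (suc r)) → reduceOuter (lift c *P x) ≃ lift c *P reduceOuter x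
    reduceOuter-lift* c (pol p) =
      P.trans (reduceOuter-cong (pol-cong (L.*ₗ-constˡ c p))) (go p)
      where
      go : ∀ p → reduceOuter (pol (L.scale c p)) ≃ lift c *P reduceOuter (pol p)
      go []      = P.trans reduceOuter-[] (P.sym (P.trans (P.*-congˡ {lift c} reduceOuter-[]) (P.zeroʳ (lift c))))
      go (x ∷ p) = begin
        reduceOuter (pol (c *P x ∷ L.scale c p))
          ≈⟨ reduceOuter-∷ (c *P x) (L.scale c p) ⟩
        lift (c *P x) +P shiftReduce (reduceOuter (pol (L.scale c p)))
          ≈⟨ P.+-cong (lift-* c x) (P.trans (shiftReduce-cong (go p)) (shiftReduce-lift* c (reduceOuter (pol p)))) ⟩
        lift c *P lift x +P lift c *P shiftReduce (reduceOuter (pol p))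
          ≈⟨ P.distribˡ (lift c) (lift x) (shiftReduce (reduceOuter (pol p))) ⟨
        lift c *P (lift x +P shiftReduce (reduceOuter (pol p)))
          ≈⟨ P.*-congˡ {lift c} (reduceOuter-∷ x p) ⟨
        lift c *P reduceOuter (pol (x ∷ p))
          ∎
        where open ≈-Reasoning P.setoid

    reduceOuter-Y* : ∀ (x : MPoly (suc r)) → reduceOuter (Y *P x) ≃ shiftReduce (reduceOuter x)
    reduceOuter-Y* (pol p) = P.trans (reduceOuter-cong (Y*-pol p)) (P.trans (reduceOuter-∷ pzero p)
      (P.trans (P.+-congʳ {shiftReduce (reduceOuter (pol p))} lift-0) (P.+-identityˡ _)))

    reduceOuter-bounded : ∀ (x : MPoly (suc r)) → Bounded (reduceOuter x)
    reduceOuter-bounded (pol p) k n≤k = C.reflexive (coeffL-≥length pzero (Vec.toList (remV (ops r) e p))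
      (≡.subst (_≤ k) (≡.sym (Vec.length-toList (remV (ops r) e p))) n≤k))

    reduceOuter-fix : ∀ x → Bounded x → reduceOuter x ≃ x
    reduceOuter-fix (pol p) = go p
      where
      go : ∀ p → Bounded (pol p) → reduceOuter (pol p) ≃ pol p
      go []      _       = reduceOuter-[]
      go (c ∷ p) bounded = begin
        reduceOuter (pol (c ∷ p))                     ≈⟨ reduceOuter-∷ c p ⟩
        lift c +P shiftReduce (reduceOuter (pol p))   ≈⟨ P.+-congˡ {lift c} (shiftReduce-cong (go p tail-bounded)) ⟩
        lift c +P shiftReduce (pol p)                 ≈⟨ P.+-congˡ {lift c} (shiftReduce-lead≃0 (pol p) (bounded n ≤-refl)) ⟩
        lift c +P Y *P pol p                          ≈⟨ pol-∷ c p ⟨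
        pol (c ∷ p)                                   ∎
        where
        open ≈-Reasoning P.setoid
        tail-bounded : Bounded (pol p)
        tail-bounded k n≤k = bounded (suc k) (≤-trans n≤k (n≤1+n k))

    lead-δ0 : lead (δ 0) ≃ pone
    lead-δ0 = C.trans (coeffOuter-δ 0 m)
      (C.trans (C.reflexive (≡.cong (λ i → embed r (coef i)) (+-comm m 1)))
               (C.trans (C.reflexive (≡.cong (embed r) coef-n)) (embed-1# r)))

    reduceOuter-fY : reduceOuter fY ≃ pzero
    reduceOuter-fY = begin
      reduceOuter fY
        ≈⟨ reduceOuter-cong fY-δ ⟩
      reduceOuter (lift a₀ +P Y *P δ 0)
        ≈⟨ reduceOuter-+ (lift a₀) (Y *P δ 0) ⟩
      reduceOuter (lift a₀) +P reduceOuter (Y *P δ 0)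
        ≈⟨ P.+-cong (reduceOuter-fix (lift a₀) (lift-bounded a₀))
                    (P.trans (reduceOuter-Y* (δ 0)) (shiftReduce-cong (reduceOuter-fix (δ 0) (δ-bounded 0)))) ⟩
      lift a₀ +P (Y *P δ 0 +P negP (lift (lead (δ 0)) *P fY))
        ≈⟨ P.+-congˡ {lift a₀} (P.+-congˡ {Y *P δ 0}
             (P.-‿cong (P.trans (P.*-congʳ {fY} (lift-cong lead-δ0)) (P.*-identityˡ fY)))) ⟩
      lift a₀ +P (Y *P δ 0 +P negP fY)
        ≈⟨ P.+-assoc (lift a₀) (Y *P δ 0) (negP fY) ⟨
      (lift a₀ +P Y *P δ 0) +P negP fY
        ≈⟨ P.+-congʳ {negP fY} fY-δ ⟨
      fY +P negP fY
        ≈⟨ P.-‿inverseʳ fY ⟩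
      pzero
        ∎
      where
      open ≈-Reasoning P.setoid
      a₀ = embed r (coef 0)

    reduceOuter-fY* : ∀ q → reduceOuter (fY *P q) ≃ pzero
    reduceOuter-fY* (pol qs) = go qs
      where
      go : ∀ qs → reduceOuter (fY *P pol qs) ≃ pzero
      go []       = P.trans (reduceOuter-cong (P.zeroʳ fY)) reduceOuter-[]
      go (c ∷ qs) = begin
        reduceOuter (fY *P pol (c ∷ qs))
          ≈⟨ reduceOuter-cong (P.trans (P.*-congˡ {fY} (pol-∷ c qs)) (P.distribˡ fY (lift c) (Y *P pol qs))) ⟩
        reduceOuter (fY *P lift c +P fY *P (Y *P pol qs))
          ≈⟨ reduceOuter-cong (P.+-cong (P.*-comm fY (lift c)) (x∙yz≈y∙xz fY Y (pol qs))) ⟩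
        reduceOuter (lift c *P fY +P Y *P (fY *P pol qs))
          ≈⟨ reduceOuter-+ (lift c *P fY) (Y *P (fY *P pol qs)) ⟩
        reduceOuter (lift c *P fY) +P reduceOuter (Y *P (fY *P pol qs))
          ≈⟨ P.+-cong (P.trans (reduceOuter-lift* c fY) (P.*-congˡ {lift c} reduceOuter-fY))
                      (P.trans (reduceOuter-Y* (fY *P pol qs)) (shiftReduce-cong (go qs))) ⟩
        lift c *P pzero +P shiftReduce pzero
          ≈⟨ P.trans (P.+-cong (P.zeroʳ (lift c)) shiftReduce-0) (P.+-identityʳ pzero) ⟩
        pzero
          ∎
        where open ≈-Reasoning P.setoid

    reduceOuter-+fY* : ∀ x q → reduceOuter (x +P fY *P q) ≃ reduceOuter x
    reduceOuter-+fY* x q = P.trans (reduceOuter-+ x (fY *P q))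
      (P.trans (P.+-congˡ {reduceOuter x} (reduceOuter-fY* q)) (P.+-identityʳ (reduceOuter x)))

    quotient : MPoly (suc r) → MPoly (suc r)
    quotient (pol [])      = pzero
    quotient (pol (c ∷ p)) = lift (lead (reduceOuter (pol p))) +P Y *P quotient (pol p)

    division : ∀ x → x ≃ reduceOuter x +P fY *P quotient x
    division (pol [])      = P.sym (P.trans (P.+-cong reduceOuter-[] (P.zeroʳ fY)) (P.+-identityˡ pzero))
    division (pol (c ∷ p)) = begin
      pol (c ∷ p)                                          ≈⟨ pol-∷ c p ⟩
      lift c +P Y *P pol p                                 ≈⟨ P.+-congˡ {lift c} (P.*-congˡ {Y} (division (pol p))) ⟩
      lift c +P Y *P (w +P fY *P q)                        ≈⟨ P.+-identityʳ _ ⟨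
      (lift c +P Y *P (w +P fY *P q)) +P pzero             ≈⟨ P.+-congˡ {lift c +P Y *P (w +P fY *P q)}
                                                                (P.-‿inverseˡ (l *P fY)) ⟨
      (lift c +P Y *P (w +P fY *P q)) +P (negP (l *P fY) +P l *P fY)
        ≈⟨ c+y[w+fq]+[n+lf]≈c+[yw+n]+f[l+yq] (lift c) Y w fY q (negP (l *P fY)) l ⟩
      (lift c +P shiftReduce w) +P fY *P (l +P Y *P q)    ≈⟨ P.+-congʳ {fY *P (l +P Y *P q)} (reduceOuter-∷ c p) ⟨
      reduceOuter (pol (c ∷ p)) +P fY *P quotient (pol (c ∷ p))
        ∎
      where
      open ≈-Reasoning P.setoid
      w = reduceOuter (pol p)
      q = quotient (pol p)
      l = lift (lead w)

    reduceOuter-*ˡ : ∀ x y → reduceOuter (x *P y) ≃ reduceOuter (reduceOuter x *P y)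
    reduceOuter-*ˡ x y = begin
      reduceOuter (x *P y)
        ≈⟨ reduceOuter-cong (P.*-congʳ {y} (division x)) ⟩
      reduceOuter ((reduceOuter x +P fY *P quotient x) *P y)
        ≈⟨ reduceOuter-cong (P.trans (P.distribʳ y (reduceOuter x) (fY *P quotient x))
                                     (P.+-congˡ {reduceOuter x *P y} (P.*-assoc fY (quotient x) y))) ⟩
      reduceOuter (reduceOuter x *P y +P fY *P (quotient x *P y))
        ≈⟨ reduceOuter-+fY* (reduceOuter x *P y) (quotient x *P y) ⟩
      reduceOuter (reduceOuter x *P y)
        ∎
      where open ≈-Reasoning P.setoid

    reduceOuter-*ʳ : ∀ x y → reduceOuter (x *P y) ≃ reduceOuter (x *P reduceOuter y)
    reduceOuter-*ʳ x y = P.trans (reduceOuter-cong (P.*-comm x y))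
      (P.trans (reduceOuter-*ˡ y x) (reduceOuter-cong (P.*-comm (reduceOuter y) x)))

  module Polynomials (r : ℕ) where
    private module C = CommutativeRing (MPolyRing r)

    eval-cong : ∀ g {x y : MPoly r} → x ≃ y → eval g x ≃ eval g y
    eval-cong []      x≃y = C.refl
    eval-cong (c ∷ g) x≃y = C.+-congˡ (C.*-cong x≃y (eval-cong g x≃y))

    pow-cong : ∀ k {x y : MPoly r} → x ≃ y → pow x k ≃ pow y k
    pow-cong zero    x≃y = C.refl
    pow-cong (suc k) x≃y = C.*-cong x≃y (pow-cong k x≃y)

    eval-tpow : ∀ k (x : MPoly r) → eval (tpow k) x ≃ pow x k
    eval-tpow zero    x = C.trans (C.+-cong (embed-1# r) (C.zeroʳ x)) (C.+-identityʳ pone)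
    eval-tpow (suc k) x = C.trans (C.+-cong (embed-0# r) (C.*-congˡ (eval-tpow k x))) (C.+-identityˡ _)

    sumTo-cong : ∀ N {f g : ℕ → MPoly r} → (∀ k → f k ≃ g k) → sumTo N f ≃ sumTo N g
    sumTo-cong zero    f≃g = C.refl
    sumTo-cong (suc N) f≃g = C.+-cong (sumTo-cong N f≃g) (f≃g N)

    sumTo-≃0 : ∀ N {f : ℕ → MPoly r} → (∀ k → f k ≃ pzero) → sumTo N f ≃ pzero
    sumTo-≃0 zero    f≃0 = C.refl
    sumTo-≃0 (suc N) f≃0 = C.trans (C.+-cong (sumTo-≃0 N f≃0) (f≃0 N)) (C.+-identityˡ pzero)

    sumTo-*ʳ : ∀ N (f : ℕ → MPoly r) w → sumTo N f *P w ≃ sumTo N (λ k → f k *P w)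
    sumTo-*ʳ zero    f w = C.zeroˡ w
    sumTo-*ʳ (suc N) f w = C.trans (C.distribʳ w (sumTo N f) (f N)) (C.+-congʳ (sumTo-*ʳ N f w))

    prodTo-cong : ∀ N {f g : ℕ → MPoly r} → (∀ k → k < N → f k ≃ g k) → prodTo N f ≃ prodTo N g
    prodTo-cong zero    f≃g = C.refl
    prodTo-cong (suc N) f≃g = C.*-cong (prodTo-cong N (λ k k<N → f≃g k (m<n⇒m<1+n k<N))) (f≃g N (n<1+n N))

  module RingHomomorphism {r r′ : ℕ} {h : MPoly r → MPoly r′}
    (isHomomorphism : IsRingHomomorphism (CommutativeRing.rawRing (MPolyRing r))
                                         (CommutativeRing.rawRing (MPolyRing r′)) h)
    where
    open IsRingHomomorphism isHomomorphism
    private module C′ = CommutativeRing (MPolyRing r′)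

    sumTo-homo : ∀ N f → h (sumTo N f) ≃ sumTo N (λ k → h (f k))
    sumTo-homo zero    f = 0#-homo
    sumTo-homo (suc N) f = C′.trans (+-homo (sumTo N f) (f N)) (C′.+-congʳ (sumTo-homo N f))

    prodTo-homo : ∀ N f → h (prodTo N f) ≃ prodTo N (λ k → h (f k))
    prodTo-homo zero    f = 1#-homo
    prodTo-homo (suc N) f = C′.trans (*-homo (prodTo N f) (f N)) (C′.*-congʳ (prodTo-homo N f))

    pow-homo : ∀ x k → h (pow x k) ≃ pow (h x) k
    pow-homo x zero    = 1#-homo
    pow-homo x (suc k) = C′.trans (*-homo x (pow x k)) (C′.*-congˡ (pow-homo x k))

    eval-homo : (∀ c → h (embed r c) ≃ embed r′ c) → ∀ g x → h (eval g x) ≃ eval g (h x)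
    eval-homo embed-homo []      x = 0#-homo
    eval-homo embed-homo (c ∷ g) x = C′.trans (+-homo (embed r c) (x *P eval g x))
      (C′.+-cong (embed-homo c) (C′.trans (*-homo x (eval g x)) (C′.*-congˡ (eval-homo embed-homo g x))))

  lift-isRingHomomorphism : ∀ r → IsRingHomomorphism (CommutativeRing.rawRing (MPolyRing r))
                                                     (CommutativeRing.rawRing (MPolyRing (suc r))) lift
  lift-isRingHomomorphism r = isRingHomomorphism lift-cong (λ _ _ → P.refl) lift-* (λ _ → P.refl) lift-0 P.refl
    where open Outer r

  eval-lift : ∀ r g (x : MPoly r) → eval g (lift x) ≃ lift (eval g x)
  eval-lift r g x = Outer.P.sym r (RingHomomorphism.eval-homo (lift-isRingHomomorphism r) (λ _ → Outer.P.refl r) g x)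

  -- p(X₁, …, X_s, X_{s+1}) ↦ p(X₁, …, X_s, X_{s+2})
  moveLast : ∀ {s} → MPoly (suc s) → MPoly (suc (suc s))
  moveLast (pol p) = pol (List.map lift p)

  module MoveLast (s : ℕ) where
    module Old = Outer s
    module New = Outer (suc s)
    module C = CommutativeRing (MPolyRing (suc s))
    module P = CommutativeRing (MPolyRing (suc (suc s)))

    coeffOuter-moveLast : ∀ (x : MPoly (suc s)) j → coeffOuter (moveLast x) j ≃ lift (coeffOuter x j)
    coeffOuter-moveLast (pol p) = go p
      where
      go : ∀ p j → coeffOuter (moveLast (pol p)) j ≃ lift (coeffL pzero p j)
      go []      j       = C.sym Old.lift-0
      go (x ∷ p) zero    = C.refl
      go (x ∷ p) (suc j) = go p j

    moveLast-cong : ∀ {x y : MPoly (suc s)} → x ≃ y → moveLast x ≃ moveLast y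
    moveLast-cong {x} {y} x≃y = New.coeffOuter-ext λ j → C.trans (coeffOuter-moveLast x j)
      (C.trans (Old.lift-cong (Old.coeffOuter-cong x≃y j)) (C.sym (coeffOuter-moveLast y j)))

    moveLast-+ : ∀ (x y : MPoly (suc s)) → moveLast (x +P y) ≃ moveLast x +P moveLast y
    moveLast-+ x y = New.coeffOuter-ext λ j → begin
      coeffOuter (moveLast (x +P y)) j                     ≈⟨ coeffOuter-moveLast (x +P y) j ⟩
      lift (coeffOuter (x +P y) j)                         ≈⟨ Old.lift-cong (Old.coeffOuter-+ x y j) ⟩
      lift (coeffOuter x j) +P lift (coeffOuter y j)       ≈⟨ C.+-cong (coeffOuter-moveLast x j) (coeffOuter-moveLast y j) ⟨
      coeffOuter (moveLast x) j +P coeffOuter (moveLast y) j ≈⟨ New.coeffOuter-+ (moveLast x) (moveLast y) j ⟨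
      coeffOuter (moveLast x +P moveLast y) j              ∎
      where open ≈-Reasoning C.setoid

    moveLast-neg : ∀ (x : MPoly (suc s)) → moveLast (negP x) ≃ negP (moveLast x)
    moveLast-neg x = New.coeffOuter-ext λ j → begin
      coeffOuter (moveLast (negP x)) j      ≈⟨ coeffOuter-moveLast (negP x) j ⟩
      lift (coeffOuter (negP x) j)          ≈⟨ Old.lift-cong (Old.coeffOuter-neg x j) ⟩
      negP (lift (coeffOuter x j))          ≈⟨ C.-‿cong (coeffOuter-moveLast x j) ⟨
      negP (coeffOuter (moveLast x) j)      ≈⟨ New.coeffOuter-neg (moveLast x) j ⟨
      coeffOuter (negP (moveLast x)) j      ∎
      where open ≈-Reasoning C.setoid

    moveLast-lift* : ∀ c (y : MPoly (suc s)) → moveLast (lift c *P y) ≃ lift (lift c) *P moveLast y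
    moveLast-lift* c y = New.coeffOuter-ext λ j → begin
      coeffOuter (moveLast (lift c *P y)) j       ≈⟨ coeffOuter-moveLast (lift c *P y) j ⟩
      lift (coeffOuter (lift c *P y) j)           ≈⟨ Old.lift-cong (Old.coeffOuter-lift* c y j) ⟩
      lift (c *P coeffOuter y j)                  ≈⟨ Old.lift-* c (coeffOuter y j) ⟩
      lift c *P lift (coeffOuter y j)             ≈⟨ C.*-congˡ {lift c} (coeffOuter-moveLast y j) ⟨
      lift c *P coeffOuter (moveLast y) j         ≈⟨ New.coeffOuter-lift* (lift c) (moveLast y) j ⟨
      coeffOuter (lift (lift c) *P moveLast y) j  ∎
      where open ≈-Reasoning C.setoid

    moveLast-Y* : ∀ (y : MPoly (suc s)) → moveLast (Old.Y *P y) ≃ New.Y *P moveLast y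
    moveLast-Y* y = New.coeffOuter-ext λ where
      zero → C.trans (coeffOuter-moveLast (Old.Y *P y) 0) (C.trans (Old.lift-cong (Old.coeffOuter-Y*-zero y))
               (C.trans Old.lift-0 (C.sym (New.coeffOuter-Y*-zero (moveLast y)))))
      (suc j) → C.trans (coeffOuter-moveLast (Old.Y *P y) (suc j)) (C.trans (Old.lift-cong (Old.coeffOuter-Y*-suc y j))
               (C.sym (C.trans (New.coeffOuter-Y*-suc (moveLast y) j) (coeffOuter-moveLast y j))))

    moveLast-* : ∀ (x y : MPoly (suc s)) → moveLast (x *P y) ≃ moveLast x *P moveLast y
    moveLast-* (pol [])      y = P.sym (P.zeroˡ (moveLast y))
    moveLast-* (pol (c ∷ p)) y = begin
      moveLast (pol (c ∷ p) *P y)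
        ≈⟨ moveLast-cong (Old.P.trans (Old.P.*-congʳ {y} (Old.pol-∷ c p)) (Old.P.distribʳ y (lift c) (Old.Y *P pol p))) ⟩
      moveLast (lift c *P y +P (Old.Y *P pol p) *P y)
        ≈⟨ P.trans (moveLast-+ (lift c *P y) ((Old.Y *P pol p) *P y))
                   (P.+-cong (moveLast-lift* c y) (P.trans (moveLast-cong (Old.P.*-assoc Old.Y (pol p) y)) (moveLast-Y* (pol p *P y)))) ⟩
      lift (lift c) *P moveLast y +P New.Y *P moveLast (pol p *P y)
        ≈⟨ P.+-congˡ {lift (lift c) *P moveLast y} (P.*-congˡ {New.Y} (moveLast-* (pol p) y)) ⟩
      lift (lift c) *P moveLast y +P New.Y *P (moveLast (pol p) *P moveLast y)
        ≈⟨ P.+-congˡ {lift (lift c) *P moveLast y} (P.*-assoc New.Y (moveLast (pol p)) (moveLast y)) ⟨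
      lift (lift c) *P moveLast y +P (New.Y *P moveLast (pol p)) *P moveLast y
        ≈⟨ P.distribʳ (moveLast y) (lift (lift c)) (New.Y *P moveLast (pol p)) ⟨
      (lift (lift c) +P New.Y *P moveLast (pol p)) *P moveLast y
        ≈⟨ P.*-congʳ {moveLast y} (New.pol-∷ (lift c) (List.map lift p)) ⟨
      moveLast (pol (c ∷ p)) *P moveLast y
        ∎
      where open ≈-Reasoning P.setoid

    moveLast-isRingHomomorphism : IsRingHomomorphism (CommutativeRing.rawRing (MPolyRing (suc s)))
                                                     (CommutativeRing.rawRing (MPolyRing (suc (suc s)))) moveLast
    moveLast-isRingHomomorphism = isRingHomomorphism moveLast-cong moveLast-+ moveLast-* moveLast-neg P.refl P.refl

    open RingHomomorphism moveLast-isRingHomomorphism public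
      using () renaming (sumTo-homo to moveLast-sumTo; prodTo-homo to moveLast-prodTo; pow-homo to moveLast-pow)

    moveLast-eval : ∀ g (x : MPoly (suc s)) → moveLast (eval g x) ≃ eval g (moveLast x)
    moveLast-eval = RingHomomorphism.eval-homo moveLast-isRingHomomorphism (λ _ → P.refl)

    moveLast-Y : moveLast Old.Y ≃ New.Y
    moveLast-Y = New.coeffOuter-ext λ where
      zero          → Old.lift-0
      (suc zero)    → C.refl
      (suc (suc j)) → C.refl

    moveLast-fY : moveLast (Monic.fY s) ≡ Monic.fY (suc s)
    moveLast-fY = ≡.cong pol (≡.sym (List.map-∘ coefficients))

    moveLast-shiftReduce : ∀ (w : MPoly (suc s)) → moveLast (Remainder.shiftReduce s w) ≃ Remainder.shiftReduce (suc s) (moveLast w)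
    moveLast-shiftReduce w = begin
      moveLast (Old.Y *P w +P negP (lift (lead w) *P Monic.fY s))
        ≈⟨ P.trans (moveLast-+ (Old.Y *P w) (negP (lift (lead w) *P Monic.fY s))) (P.+-cong (moveLast-Y* w)
                   (P.trans (moveLast-neg (lift (lead w) *P Monic.fY s)) (P.-‿cong (moveLast-lift* (lead w) (Monic.fY s))))) ⟩
      New.Y *P moveLast w +P negP (lift (lift (lead w)) *P moveLast (Monic.fY s))
        ≈⟨ P.+-congˡ {New.Y *P moveLast w} (P.-‿cong (P.*-cong (New.lift-cong (C.sym (coeffOuter-moveLast w m)))
                                                              (P.reflexive moveLast-fY))) ⟩
      Remainder.shiftReduce (suc s) (moveLast w)
        ∎
      where
      open ≈-Reasoning P.setoid
      open Remainder s using (lead)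

    reduceOuter-moveLast : ∀ (x : MPoly (suc s)) → reduceOuter (moveLast x) ≃ moveLast (reduceOuter x)
    reduceOuter-moveLast (pol p) = go p
      where
      module Old-R = Remainder s
      module New-R = Remainder (suc s)
      go : ∀ p → reduceOuter (moveLast (pol p)) ≃ moveLast (reduceOuter (pol p))
      go []      = P.trans New-R.reduceOuter-[] (P.sym (moveLast-cong Old-R.reduceOuter-[]))
      go (c ∷ p) = begin
        reduceOuter (pol (lift c ∷ List.map lift p))
          ≈⟨ New-R.reduceOuter-∷ (lift c) (List.map lift p) ⟩
        lift (lift c) +P New-R.shiftReduce (reduceOuter (moveLast (pol p)))
          ≈⟨ P.+-congˡ {lift (lift c)} (P.trans (New-R.shiftReduce-cong (go p))
                                                     (P.sym (moveLast-shiftReduce (reduceOuter (pol p))))) ⟩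
        lift (lift c) +P moveLast (Old-R.shiftReduce (reduceOuter (pol p)))
          ≈⟨ P.trans (moveLast-cong (Old-R.reduceOuter-∷ c p))
                     (moveLast-+ (lift c) (Old-R.shiftReduce (reduceOuter (pol p)))) ⟨
        moveLast (reduceOuter (pol (c ∷ p)))
          ∎
        where open ≈-Reasoning P.setoid

  module Kernel (s : ℕ) where
    module X = Outer s
    module Y = Outer (suc s)
    module XM = Monic s
    module YM = Monic (suc s)
    module XR = Remainder s
    module YR = Remainder (suc s)
    module C = CommutativeRing (MPolyRing (suc s))
    module P = CommutativeRing (MPolyRing (suc (suc s)))
    open RingIdentities (MPolyRing (suc (suc s))) using (x+y≈u+v⇒x-v≈u-y; ao+[b[xo-f]+fr]≈[a+xb]o+f[r-b])
    open CommutativeSemigroupProperties P.*-commutativeSemigroup using (x∙yz≈y∙xz)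

    -- O⁽²⁾_f(X, Y) for X = X_{s+1} and Y = X_{s+2}
    O : MPoly (suc (suc s))
    O = Y.monomials n XM.δ

    coeffOuter-O : ∀ j → coeffOuter O j ≃ XM.δ j
    coeffOuter-O j = case j <? n of λ where
      (yes j<n) → Y.coeffOuter-monomials-< n XM.δ j<n
      (no  j≮n) → C.trans (Y.coeffOuter-monomials-≥ n XM.δ (≮⇒≥ j≮n)) (C.sym (XM.δ-vanishes (≮⇒≥ j≮n)))

    O-bounded : Y.Bounded O
    O-bounded k n≤k = C.trans (coeffOuter-O k) (XM.δ-vanishes n≤k)

    -- (X − Y) O = f(X) − f(Y), arranged without subtraction
    YO+fX≃XO+fY : Y.Y *P O +P lift XM.fY ≃ lift X.Y *P O +P YM.fY
    YO+fX≃XO+fY = Y.coeffOuter-ext go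
      where
      open ≈-Reasoning C.setoid
      a₀ = embed s (coef 0)
      go : ∀ j → coeffOuter (Y.Y *P O +P lift XM.fY) j ≃ coeffOuter (lift X.Y *P O +P YM.fY) j
      go zero = begin
        coeffOuter (Y.Y *P O +P lift XM.fY) 0             ≈⟨ Y.coeffOuter-+ (Y.Y *P O) (lift XM.fY) 0 ⟩
        coeffOuter (Y.Y *P O) 0 +P XM.fY                  ≈⟨ C.+-congʳ {XM.fY} (Y.coeffOuter-Y*-zero O) ⟩
        pzero +P XM.fY                                    ≈⟨ C.+-identityˡ XM.fY ⟩
        XM.fY                                             ≈⟨ XM.fY-δ ⟩
        lift a₀ +P X.Y *P XM.δ 0                          ≈⟨ C.+-comm (lift a₀) (X.Y *P XM.δ 0) ⟩
        X.Y *P XM.δ 0 +P lift a₀                          ≈⟨ C.+-cong (C.trans (Y.coeffOuter-lift* X.Y O 0)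
                                                                               (C.*-congˡ {X.Y} (coeffOuter-O 0)))
                                                                      (YM.coeffOuter-fY 0) ⟨
        coeffOuter (lift X.Y *P O) 0 +P coeffOuter YM.fY 0 ≈⟨ Y.coeffOuter-+ (lift X.Y *P O) YM.fY 0 ⟨
        coeffOuter (lift X.Y *P O +P YM.fY) 0             ∎
      go (suc i) = begin
        coeffOuter (Y.Y *P O +P lift XM.fY) (suc i)       ≈⟨ Y.coeffOuter-+ (Y.Y *P O) (lift XM.fY) (suc i) ⟩
        coeffOuter (Y.Y *P O) (suc i) +P pzero            ≈⟨ C.trans (C.+-identityʳ _) (Y.coeffOuter-Y*-suc O i) ⟩
        coeffOuter O i                                    ≈⟨ coeffOuter-O i ⟩
        XM.δ i                                            ≈⟨ XM.δ-step i ⟩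
        lift aᵢ₊₁ +P X.Y *P XM.δ (suc i)                  ≈⟨ C.+-comm (lift aᵢ₊₁) (X.Y *P XM.δ (suc i)) ⟩
        X.Y *P XM.δ (suc i) +P lift aᵢ₊₁                  ≈⟨ C.+-cong (C.trans (Y.coeffOuter-lift* X.Y O (suc i))
                                                                               (C.*-congˡ {X.Y} (coeffOuter-O (suc i))))
                                                                      (YM.coeffOuter-fY (suc i)) ⟨
        coeffOuter (lift X.Y *P O) (suc i) +P coeffOuter YM.fY (suc i) ≈⟨ Y.coeffOuter-+ (lift X.Y *P O) YM.fY (suc i) ⟨
        coeffOuter (lift X.Y *P O +P YM.fY) (suc i)       ∎
        where aᵢ₊₁ = embed s (coef (suc i))

    reduceOuter-Y*O : reduceOuter (Y.Y *P O) ≃ lift X.Y *P O +P negP (lift XM.fY)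
    reduceOuter-Y*O = begin
      reduceOuter (Y.Y *P O)                          ≈⟨ YR.reduceOuter-Y* O ⟩
      YR.shiftReduce (reduceOuter O)                  ≈⟨ YR.shiftReduce-cong (YR.reduceOuter-fix O O-bounded) ⟩
      Y.Y *P O +P negP (lift (YR.lead O) *P YM.fY)    ≈⟨ P.+-congˡ {Y.Y *P O} (P.-‿cong (P.trans
                                                           (P.*-congʳ {YM.fY} (Y.lift-cong lead-O)) (P.*-identityˡ YM.fY))) ⟩
      Y.Y *P O +P negP YM.fY                          ≈⟨ x+y≈u+v⇒x-v≈u-y (Y.Y *P O) (lift XM.fY) (lift X.Y *P O) YM.fY
                                                                          YO+fX≃XO+fY ⟩
      lift X.Y *P O +P negP (lift XM.fY)              ∎
      where
      open ≈-Reasoning P.setoid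
      lead-O : YR.lead O ≃ pone
      lead-O = C.trans (coeffOuter-O m) XM.δ-last

    transfer : ∀ A → Σ (MPoly (suc (suc s))) λ E →
               reduceOuter (moveLast A *P O) ≃ lift A *P O +P lift XM.fY *P E
    transfer (pol as) = go as
      where
      go : ∀ as → Σ (MPoly (suc (suc s))) λ E →
           reduceOuter (moveLast (pol as) *P O) ≃ lift (pol as) *P O +P lift XM.fY *P E
      go []       = pzero , P.trans (YR.reduceOuter-cong (P.zeroˡ O)) (P.trans YR.reduceOuter-[] (P.sym
        (P.trans (P.+-cong (P.trans (P.*-congʳ {O} Y.lift-0) (P.zeroˡ O)) (P.zeroʳ (lift XM.fY))) (P.+-identityˡ pzero))))
      go (c ∷ as) = reduceOuter (Y.Y *P E) +P negP (lift B) , (begin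
        reduceOuter (moveLast (pol (c ∷ as)) *P O)
          ≈⟨ YR.reduceOuter-cong (P.trans (P.*-congʳ {O} (Y.pol-∷ (lift c) (List.map lift as)))
               (P.trans (P.distribʳ O (lift (lift c)) (Y.Y *P M)) (P.+-congˡ {lift (lift c) *P O} (P.*-assoc Y.Y M O)))) ⟩
        reduceOuter (lift (lift c) *P O +P Y.Y *P (M *P O))
          ≈⟨ YR.reduceOuter-+ (lift (lift c) *P O) (Y.Y *P (M *P O)) ⟩
        reduceOuter (lift (lift c) *P O) +P reduceOuter (Y.Y *P (M *P O))
          ≈⟨ P.+-cong (P.trans (YR.reduceOuter-lift* (lift c) O) (P.*-congˡ {lift (lift c)} (YR.reduceOuter-fix O O-bounded)))
                      (YR.reduceOuter-*ʳ Y.Y (M *P O)) ⟩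
        lift (lift c) *P O +P reduceOuter (Y.Y *P reduceOuter (M *P O))
          ≈⟨ P.+-congˡ {lift (lift c) *P O} (YR.reduceOuter-cong (P.*-congˡ {Y.Y} M*O≃)) ⟩
        lift (lift c) *P O +P reduceOuter (Y.Y *P (lift B *P O +P lift XM.fY *P E))
          ≈⟨ P.+-congˡ {lift (lift c) *P O} (YR.reduceOuter-cong (P.trans (P.distribˡ Y.Y (lift B *P O) (lift XM.fY *P E))
               (P.+-cong (x∙yz≈y∙xz Y.Y (lift B) O) (x∙yz≈y∙xz Y.Y (lift XM.fY) E)))) ⟩
        lift (lift c) *P O +P reduceOuter (lift B *P (Y.Y *P O) +P lift XM.fY *P (Y.Y *P E))
          ≈⟨ P.+-congˡ {lift (lift c) *P O} (P.trans (YR.reduceOuter-+ (lift B *P (Y.Y *P O)) (lift XM.fY *P (Y.Y *P E)))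
               (P.+-cong (P.trans (YR.reduceOuter-lift* B (Y.Y *P O)) (P.*-congˡ {lift B} reduceOuter-Y*O))
                         (YR.reduceOuter-lift* XM.fY (Y.Y *P E)))) ⟩
        lift (lift c) *P O +P (lift B *P (lift X.Y *P O +P negP (lift XM.fY)) +P lift XM.fY *P reduceOuter (Y.Y *P E))
          ≈⟨ ao+[b[xo-f]+fr]≈[a+xb]o+f[r-b] (lift (lift c)) O (lift B) (lift X.Y) (lift XM.fY) (reduceOuter (Y.Y *P E)) ⟩
        (lift (lift c) +P lift X.Y *P lift B) *P O +P lift XM.fY *P (reduceOuter (Y.Y *P E) +P negP (lift B))
          ≈⟨ P.+-congʳ {lift XM.fY *P (reduceOuter (Y.Y *P E) +P negP (lift B))}
               (P.*-congʳ {O} (P.trans (Y.lift-cong (X.pol-∷ c as)) (P.+-congˡ {lift (lift c)} (Y.lift-* X.Y B)))) ⟨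
        lift (pol (c ∷ as)) *P O +P lift XM.fY *P (reduceOuter (Y.Y *P E) +P negP (lift B))
          ∎)
        where
        open ≈-Reasoning P.setoid
        B = pol as
        M = moveLast B
        E = proj₁ (go as)
        M*O≃ = proj₂ (go as)

  reduceAll-0 : ∀ r → reduceAll r pzero ≃ pzero
  reduceAll-cong : ∀ r {x y : MPoly r} → x ≃ y → reduceAll r x ≃ reduceAll r y
  reduceAll-coeffOuter : ∀ r (x : MPoly (suc r)) k → coeffOuter (reduceAll (suc r) x) k ≃ reduceAll r (coeffOuter (reduceOuter x) k)
  reduceAll-reduceOuter : ∀ r {x y : MPoly (suc r)} → reduceOuter x ≃ reduceOuter y → reduceAll (suc r) x ≃ reduceAll (suc r) y

  reduceAll-coeffOuter r (pol p) = Coefficients.coeff-map r (reduceAll r) (reduceAll-0 r) (unpol (reduceOuter (pol p)))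

  reduceAll-0 zero    = ⟨ K.refl ⟩
  reduceAll-0 (suc r) = Outer.coeffOuter-ext r λ k → C.trans (reduceAll-coeffOuter r pzero k)
    (C.trans (reduceAll-cong r (Outer.coeffOuter-cong r (Remainder.reduceOuter-[] r) k)) (reduceAll-0 r))
    where module C = CommutativeRing (MPolyRing r)

  reduceAll-cong zero    x≃y = x≃y
  reduceAll-cong (suc r) {x} {y} x≃y = reduceAll-reduceOuter r {x} {y} (Remainder.reduceOuter-cong r x≃y)

  reduceAll-reduceOuter r {x} {y} ρx≃ρy = Outer.coeffOuter-ext r λ k → C.trans (reduceAll-coeffOuter r x k)
    (C.trans (reduceAll-cong r (Outer.coeffOuter-cong r ρx≃ρy k)) (C.sym (reduceAll-coeffOuter r y k)))
    where module C = CommutativeRing (MPolyRing r)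

  reduceAll-+ : ∀ r (x y : MPoly r) → reduceAll r (x +P y) ≃ reduceAll r x +P reduceAll r y
  reduceAll-+ zero    x y = CommutativeRing.refl (MPolyRing zero)
  reduceAll-+ (suc r) x y = coeffOuter-ext λ k → begin
    coeffOuter (reduceAll (suc r) (x +P y)) k
      ≈⟨ reduceAll-coeffOuter r (x +P y) k ⟩
    reduceAll r (coeffOuter (reduceOuter (x +P y)) k)
      ≈⟨ reduceAll-cong r (C.trans (coeffOuter-cong (Remainder.reduceOuter-+ r x y) k)
                                   (coeffOuter-+ (reduceOuter x) (reduceOuter y) k)) ⟩
    reduceAll r (coeffOuter (reduceOuter x) k +P coeffOuter (reduceOuter y) k)
      ≈⟨ reduceAll-+ r _ _ ⟩
    reduceAll r (coeffOuter (reduceOuter x) k) +P reduceAll r (coeffOuter (reduceOuter y) k)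
      ≈⟨ C.+-cong (reduceAll-coeffOuter r x k) (reduceAll-coeffOuter r y k) ⟨
    coeffOuter (reduceAll (suc r) x) k +P coeffOuter (reduceAll (suc r) y) k
      ≈⟨ coeffOuter-+ (reduceAll (suc r) x) (reduceAll (suc r) y) k ⟨
    coeffOuter (reduceAll (suc r) x +P reduceAll (suc r) y) k
      ∎
    where
    open Outer r
    open ≈-Reasoning C.setoid

  reduceAll-embed* : ∀ r c (x : MPoly r) → reduceAll r (embed r c *P x) ≃ embed r c *P reduceAll r x
  reduceAll-embed* zero    c x = CommutativeRing.refl (MPolyRing zero)
  reduceAll-embed* (suc r) c x = coeffOuter-ext λ k → begin
    coeffOuter (reduceAll (suc r) (lift (embed r c) *P x)) k
      ≈⟨ reduceAll-coeffOuter r (lift (embed r c) *P x) k ⟩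
    reduceAll r (coeffOuter (reduceOuter (lift (embed r c) *P x)) k)
      ≈⟨ reduceAll-cong r (C.trans (coeffOuter-cong (Remainder.reduceOuter-lift* r (embed r c) x) k)
                                   (coeffOuter-lift* (embed r c) (reduceOuter x) k)) ⟩
    reduceAll r (embed r c *P coeffOuter (reduceOuter x) k)
      ≈⟨ reduceAll-embed* r c _ ⟩
    embed r c *P reduceAll r (coeffOuter (reduceOuter x) k)
      ≈⟨ C.*-congˡ {embed r c} (reduceAll-coeffOuter r x k) ⟨
    embed r c *P coeffOuter (reduceAll (suc r) x) k
      ≈⟨ coeffOuter-lift* (embed r c) (reduceAll (suc r) x) k ⟨
    coeffOuter (lift (embed r c) *P reduceAll (suc r) x) k
      ∎
    where
    open Outer r
    open ≈-Reasoning C.setoid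

  reduceAll-sumTo : ∀ r N (f : ℕ → MPoly r) → reduceAll r (sumTo N f) ≃ sumTo N (λ k → reduceAll r (f k))
  reduceAll-sumTo r zero    f = reduceAll-0 r
  reduceAll-sumTo r (suc N) f = C.trans (reduceAll-+ r (sumTo N f) (f N)) (C.+-congʳ (reduceAll-sumTo r N f))
    where module C = CommutativeRing (MPolyRing r)

  data Reduced : (r : ℕ) → MPoly r → Set (c ⊔ ℓ) where
    reduced-cst : ∀ x → Reduced zero (cst x)
    reduced-pol : ∀ {r} {x : MPoly (suc r)} → Outer.Bounded r x → (∀ j → Reduced r (coeffOuter x j)) →
                  Reduced (suc r) x

  Reduced-coeffOuter : ∀ {r} {x : MPoly (suc r)} → Reduced (suc r) x → ∀ j → Reduced r (coeffOuter x j)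
  Reduced-coeffOuter (reduced-pol _ reduced) = reduced

  Reduced-bounded : ∀ {r} {x : MPoly (suc r)} → Reduced (suc r) x → Outer.Bounded r x
  Reduced-bounded (reduced-pol bounded _) = bounded

  Reduced-cong : ∀ {r} {x y : MPoly r} → x ≃ y → Reduced r x → Reduced r y
  Reduced-cong {y = cst y} _   (reduced-cst x) = reduced-cst y
  Reduced-cong {suc r} x≃y (reduced-pol bounded reduced) = reduced-pol
    (λ k n≤k → C.trans (C.sym (coeffOuter-cong x≃y k)) (bounded k n≤k))
    (λ j → Reduced-cong (coeffOuter-cong x≃y j) (reduced j))
    where open Outer r

  Reduced-0 : ∀ r → Reduced r pzero
  Reduced-0 zero    = reduced-cst K.0#
  Reduced-0 (suc r) = reduced-pol (λ _ _ → Outer.C.refl r) λ _ → Reduced-0 r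

  Reduced-1 : ∀ r → Reduced r pone
  Reduced-1 zero    = reduced-cst K.1#
  Reduced-1 (suc r) = reduced-pol (Outer.lift-bounded r pone) λ where
    zero    → Reduced-1 r
    (suc j) → Reduced-0 r

  Reduced-+ : ∀ {r} {x y : MPoly r} → Reduced r x → Reduced r y → Reduced r (x +P y)
  Reduced-+ (reduced-cst x) (reduced-cst y) = reduced-cst (x K.+ y)
  Reduced-+ {suc r} {x} {y} (reduced-pol x-bounded x-reduced) (reduced-pol y-bounded y-reduced) = reduced-pol
    (λ k n≤k → C.trans (coeffOuter-+ x y k) (C.trans (C.+-cong (x-bounded k n≤k) (y-bounded k n≤k)) (C.+-identityˡ pzero)))
    (λ j → Reduced-cong (C.sym (coeffOuter-+ x y j)) (Reduced-+ (x-reduced j) (y-reduced j)))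
    where open Outer r

  Reduced-neg : ∀ {r} {x : MPoly r} → Reduced r x → Reduced r (negP x)
  Reduced-neg (reduced-cst x) = reduced-cst (K.- x)
  Reduced-neg {suc r} {x} (reduced-pol x-bounded x-reduced) = reduced-pol
    (λ k n≤k → C.trans (coeffOuter-neg x k) (C.trans (C.-‿cong (x-bounded k n≤k)) -0#≈0#))
    (λ j → Reduced-cong (C.sym (coeffOuter-neg x j)) (Reduced-neg (x-reduced j)))
    where
    open Outer r
    open RingProperties C.ring using (-0#≈0#)

  Reduced-embed* : ∀ {r} c {x : MPoly r} → Reduced r x → Reduced r (embed r c *P x)
  Reduced-embed* c (reduced-cst x) = reduced-cst (c K.* x)
  Reduced-embed* {suc r} c {x} (reduced-pol x-bounded x-reduced) = reduced-pol
    (λ k n≤k → C.trans (coeffOuter-lift* (embed r c) x k) (C.trans (C.*-congˡ {embed r c} (x-bounded k n≤k)) (C.zeroʳ _)))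
    (λ j → Reduced-cong (C.sym (coeffOuter-lift* (embed r c) x j)) (Reduced-embed* c (x-reduced j)))
    where open Outer r

  Reduced-*embed : ∀ {r} c {x : MPoly r} → Reduced r x → Reduced r (x *P embed r c)
  Reduced-*embed {r} c {x} reduced =
    Reduced-cong (CommutativeRing.*-comm (MPolyRing r) (embed r c) x) (Reduced-embed* c reduced)

  reduceAll-fix : ∀ {r} {x : MPoly r} → Reduced r x → reduceAll r x ≃ x
  reduceAll-fix (reduced-cst x) = ⟨ K.refl ⟩
  reduceAll-fix {suc r} {x} (reduced-pol bounded reduced) = coeffOuter-ext λ k → C.trans (reduceAll-coeffOuter r x k)
    (C.trans (reduceAll-cong r (coeffOuter-cong (Remainder.reduceOuter-fix r x bounded) k)) (reduceAll-fix (reduced k)))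
    where open Outer r

  Reduced-reduceOuter : ∀ r (x : MPoly (suc r)) → (∀ j → Reduced r (coeffOuter x j)) → Reduced (suc r) (reduceOuter x)
  Reduced-reduceOuter r (pol p) p-reduced = reduced-pol (reduceOuter-bounded (pol p)) (go p p-reduced)
    where
    open Outer r
    open Monic r
    open Remainder r

    CoeffsReduced : MPoly (suc r) → Set (c ⊔ ℓ)
    CoeffsReduced x = ∀ j → Reduced r (coeffOuter x j)

    CoeffsReduced-cong : ∀ {x y} → x ≃ y → CoeffsReduced x → CoeffsReduced y
    CoeffsReduced-cong x≃y reduced j = Reduced-cong (coeffOuter-cong x≃y j) (reduced j)

    horner : ∀ c w → Reduced r c → CoeffsReduced w → CoeffsReduced (lift c +P shiftReduce w)
    horner c w c-reduced w-reduced j = Reduced-cong (C.sym coeff-split)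
      (Reduced-+ (lift-part j) (Reduced-+ (Y-part j) (Reduced-neg f-part)))
      where
      coeff-split : coeffOuter (lift c +P shiftReduce w) j
                    ≃ coeffOuter (lift c) j +P (coeffOuter (Y *P w) j +P negP (coeffOuter (lift (lead w) *P fY) j))
      coeff-split = C.trans (coeffOuter-+ (lift c) (shiftReduce w) j) (C.+-congˡ {coeffOuter (lift c) j}
        (C.trans (coeffOuter-+ (Y *P w) (negP (lift (lead w) *P fY)) j)
                 (C.+-congˡ {coeffOuter (Y *P w) j} (coeffOuter-neg (lift (lead w) *P fY) j))))
      lift-part : ∀ j → Reduced r (coeffOuter (lift c) j)
      lift-part zero    = c-reduced
      lift-part (suc j) = Reduced-0 r
      Y-part : ∀ j → Reduced r (coeffOuter (Y *P w) j)
      Y-part zero    = Reduced-cong (C.sym (coeffOuter-Y*-zero w)) (Reduced-0 r)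
      Y-part (suc j) = Reduced-cong (C.sym (coeffOuter-Y*-suc w j)) (w-reduced j)
      f-part : Reduced r (coeffOuter (lift (lead w) *P fY) j)
      f-part = Reduced-cong (C.sym (C.trans (coeffOuter-lift* (lead w) fY j) (C.*-congˡ {lead w} (coeffOuter-fY j))))
                              (Reduced-*embed (coef j) (w-reduced m))

    go : ∀ p → CoeffsReduced (pol p) → CoeffsReduced (reduceOuter (pol p))
    go []      _         = CoeffsReduced-cong (P.sym reduceOuter-[]) (λ _ → Reduced-0 r)
    go (c ∷ p) reduced = CoeffsReduced-cong (P.sym (reduceOuter-∷ c p))
      (horner c (reduceOuter (pol p)) (reduced 0) (go p (λ j → reduced (suc j))))

  var-last : ∀ r → var (suc r) r ≡ Outer.Y r
  var-last r with r ≡ᵇ r | ≡⇒≡ᵇ r r ≡.refl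
  ... | true | _ = ≡.refl

  var-lift : ∀ r j → j < r → var (suc r) j ≡ lift (var r j)
  var-lift r j j<r with j ≡ᵇ r | ≡ᵇ⇒≡ j r
  ... | false | _   = ≡.refl
  ... | true  | j≡r = ⊥-elim (<⇒≢ j<r (j≡r _))

  O2at-kernel : ∀ s → O2at (suc (suc s)) s ≃ Kernel.O s
  O2at-kernel s = Polynomials.sumTo-cong (suc (suc s)) n λ k → P.*-cong
    (P.trans (P.reflexive (≡.cong (eval (D k)) (≡.trans (var-lift (suc s) s (n<1+n s)) (≡.cong lift (var-last s)))))
             (eval-lift (suc s) (D k) (Outer.Y s)))
    (P.reflexive (≡.cong (λ y → pow y k) (var-last (suc s))))
    where module P = CommutativeRing (MPolyRing (suc (suc s)))

  moveLast-O2at : ∀ t j → j < t → moveLast (O2at (suc t) j) ≃ O2at (suc (suc t)) j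
  moveLast-O2at t j j<t = begin
    moveLast (O2at (suc t) j)
      ≈⟨ moveLast-sumTo n (λ k → eval (D k) (var (suc t) j) *P pow (var (suc t) t) k) ⟩
    sumTo n (λ k → moveLast (eval (D k) (var (suc t) j) *P pow (var (suc t) t) k))
      ≈⟨ sumTo-cong n (λ k → P.trans (moveLast-* (eval (D k) (var (suc t) j)) (pow (var (suc t) t) k))
           (P.*-cong (P.trans (moveLast-eval (D k) (var (suc t) j)) (eval-cong (D k) moveLast-var))
                     (P.trans (moveLast-pow (var (suc t) t) k) (pow-cong k moveLast-var-last)))) ⟩
    O2at (suc (suc t)) j
      ∎
    where
    open MoveLast t
    open Polynomials (suc (suc t))
    open ≈-Reasoning P.setoid
    moveLast-var : moveLast (var (suc t) j) ≃ var (suc (suc t)) j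
    moveLast-var = P.reflexive (≡.trans (≡.cong moveLast (var-lift t j j<t))
      (≡.trans (≡.cong lift (≡.sym (var-lift t j j<t))) (≡.sym (var-lift (suc t) j (m<n⇒m<1+n j<t)))))
    moveLast-var-last : moveLast (var (suc t) t) ≃ var (suc (suc t)) (suc t)
    moveLast-var-last = P.trans (P.reflexive (≡.cong moveLast (var-last t)))
      (P.trans moveLast-Y (P.reflexive (≡.sym (var-last (suc t)))))

  Weil-remainder : ∀ s → Weil (suc s) ≃ reduceOuter (prodTo s (O2at (suc s)))
  Weil-remainder zero          = P.sym (reduceOuter-fix pone (lift-bounded pone))
    where
    open Outer 0
    open Remainder 0
  Weil-remainder (suc zero)    = P.sym (P.trans (reduceOuter-cong (P.*-identityˡ (O2at 2 0)))
    (reduceOuter-fix (O2at 2 0) λ k n≤k → C.trans (coeffOuter-cong (O2at-kernel 0) k) (Kernel.O-bounded 0 k n≤k)))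
    where
    open Outer 1
    open Remainder 1
  Weil-remainder (suc (suc s)) = CommutativeRing.refl (MPolyRing (suc (suc (suc s))))

  Weil-kernel : ∀ s → Weil (suc (suc s)) ≃ reduceOuter (moveLast (prodTo s (O2at (suc s))) *P Kernel.O s)
  Weil-kernel s = P.trans (Weil-remainder (suc s)) (reduceOuter-cong (P.*-cong
    (P.trans (prodTo-cong s (λ j j<s → P.sym (moveLast-O2at s j j<s))) (P.sym (moveLast-prodTo s (O2at (suc s)))))
    (O2at-kernel s)))
    where
    open Outer (suc s)
    open Remainder (suc s)
    open Polynomials (suc (suc s))
    open MoveLast s using (moveLast-prodTo)

  module WeilStep (s : ℕ) where
    open Kernel s

    A : MPoly (suc s)
    A = prodTo s (O2at (suc s))

    W : MPoly (suc s)
    W = Weil (suc s)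

    Reduced-lift*δ : ∀ {v} k → Reduced s v → Reduced (suc s) (lift v *P XM.δ k)
    Reduced-lift*δ {v} k v-reduced = reduced-pol
      (λ i n≤i → X.C.trans (X.coeffOuter-lift* v (XM.δ k) i)
                           (X.C.trans (X.C.*-congˡ {v} (XM.δ-bounded k i n≤i)) (X.C.zeroʳ v)))
      (λ i → Reduced-cong (X.C.sym (X.C.trans (X.coeffOuter-lift* v (XM.δ k) i) (X.C.*-congˡ {v} (XM.coeffOuter-δ k i))))
                          (Reduced-*embed (coef (k + i + 1)) v-reduced))

    Reduced-coeffOuter-moveLast*O : ∀ V → (∀ j → Reduced s (coeffOuter V j)) →
                                    ∀ k → Reduced (suc s) (coeffOuter (moveLast V *P O) k)
    Reduced-coeffOuter-moveLast*O (pol vs) = go vs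
      where
      go : ∀ vs → (∀ j → Reduced s (coeffL pzero vs j)) → ∀ k → Reduced (suc s) (coeffOuter (moveLast (pol vs) *P O) k)
      go []       _          k = Reduced-0 (suc s)
      go (v ∷ vs) vs-reduced k = Reduced-cong (C.sym coeff-split)
        (Reduced-+ (Reduced-cong (C.sym (C.trans (Y.coeffOuter-lift* (lift v) O k) (C.*-congˡ {lift v} (coeffOuter-O k))))
                                 (Reduced-lift*δ k (vs-reduced 0)))
                   (shifted k))
        where
        Z = moveLast (pol vs) *P O
        coeff-split : coeffOuter (moveLast (pol (v ∷ vs)) *P O) k ≃ coeffOuter (lift (lift v) *P O) k +P coeffOuter (Y.Y *P Z) k
        coeff-split = C.trans (Y.coeffOuter-cong (P.trans (P.*-congʳ {O} (Y.pol-∷ (lift v) (List.map lift vs)))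
                        (P.trans (P.distribʳ O (lift (lift v)) (Y.Y *P moveLast (pol vs)))
                                 (P.+-congˡ {lift (lift v) *P O} (P.*-assoc Y.Y (moveLast (pol vs)) O)))) k)
                        (Y.coeffOuter-+ (lift (lift v) *P O) (Y.Y *P Z) k)
        shifted : ∀ k → Reduced (suc s) (coeffOuter (Y.Y *P Z) k)
        shifted zero    = Reduced-cong (C.sym (Y.coeffOuter-Y*-zero Z)) (Reduced-0 (suc s))
        shifted (suc k) = Reduced-cong (C.sym (Y.coeffOuter-Y*-suc Z k)) (go vs (λ j → vs-reduced (suc j)) k)

    Weil≃reduceOuter-moveLast-W*O : Weil (suc (suc s)) ≃ reduceOuter (moveLast W *P O)
    Weil≃reduceOuter-moveLast-W*O = begin
      Weil (suc (suc s))                            ≈⟨ Weil-kernel s ⟩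
      reduceOuter (moveLast A *P O)                 ≈⟨ YR.reduceOuter-*ˡ (moveLast A) O ⟩
      reduceOuter (reduceOuter (moveLast A) *P O)   ≈⟨ YR.reduceOuter-cong (P.*-congʳ {O} (MoveLast.reduceOuter-moveLast s A)) ⟩
      reduceOuter (moveLast (reduceOuter A) *P O)   ≈⟨ YR.reduceOuter-cong (P.*-congʳ {O}
                                                         (MoveLast.moveLast-cong s (Weil-remainder s))) ⟨
      reduceOuter (moveLast W *P O)                 ∎
      where open ≈-Reasoning P.setoid

    Reduced-Weil-suc : Reduced (suc s) W → Reduced (suc (suc s)) (Weil (suc (suc s)))
    Reduced-Weil-suc W-reduced = Reduced-cong (P.sym Weil≃reduceOuter-moveLast-W*O)
      (Reduced-reduceOuter (suc s) (moveLast W *P O) (Reduced-coeffOuter-moveLast*O W (Reduced-coeffOuter W-reduced)))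

    coeffOuter-Weil-suc : Reduced (suc s) W → ∀ k → coeffOuter (Weil (suc (suc s))) k ≃ reduceAll (suc s) (XM.δ k *P W)
    coeffOuter-Weil-suc W-reduced k = C.trans
      (C.sym (reduceAll-fix (Reduced-coeffOuter (Reduced-Weil-suc W-reduced) k)))
      (reduceAll-reduceOuter s {coeffOuter (Weil (suc (suc s))) k} {XM.δ k *P W} (begin
        reduceOuter (coeffOuter (Weil (suc (suc s))) k)
          ≈⟨ XR.reduceOuter-cong coeff≃ ⟩
        reduceOuter (A *P XM.δ k +P XM.fY *P coeffOuter E k)
          ≈⟨ XR.reduceOuter-+fY* (A *P XM.δ k) (coeffOuter E k) ⟩
        reduceOuter (A *P XM.δ k)
          ≈⟨ XR.reduceOuter-*ˡ A (XM.δ k) ⟩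
        reduceOuter (reduceOuter A *P XM.δ k)
          ≈⟨ XR.reduceOuter-cong (C.trans (C.*-congʳ {XM.δ k} (C.sym (Weil-remainder s))) (C.*-comm W (XM.δ k))) ⟩
        reduceOuter (XM.δ k *P W)
          ∎))
      where
      open ≈-Reasoning C.setoid
      E = proj₁ (transfer A)
      coeff≃ : coeffOuter (Weil (suc (suc s))) k ≃ A *P XM.δ k +P XM.fY *P coeffOuter E k
      coeff≃ = C.trans (Y.coeffOuter-cong (P.trans (Weil-kernel s) (proj₂ (transfer A))) k)
        (C.trans (Y.coeffOuter-+ (lift A *P O) (lift XM.fY *P E) k)
                 (C.+-cong (C.trans (Y.coeffOuter-lift* A O k) (C.*-congˡ {A} (coeffOuter-O k)))
                           (Y.coeffOuter-lift* XM.fY E k)))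

  Reduced-Weil : ∀ s → Reduced (suc s) (Weil (suc s))
  Reduced-Weil zero    = Reduced-1 1
  Reduced-Weil (suc s) = WeilStep.Reduced-Weil-suc s (Reduced-Weil s)

  module Expansions (s : ℕ) where
    open Kernel s using (module X; module Y; module XM; module YM; module C; module P)
    open WeilStep s using (W; Reduced-Weil-suc; coeffOuter-Weil-suc)

    W-reduced : Reduced (suc s) W
    W-reduced = Reduced-Weil s

    B : ℕ → MPoly (suc s)
    B k = reduceAll (suc s) (XM.δ k *P W)

    Weil≃monomials : Weil (suc (suc s)) ≃ Y.monomials n B
    Weil≃monomials = Y.≃-monomials (Weil (suc (suc s))) B
      (Reduced-bounded (Reduced-Weil-suc W-reduced)) (λ j _ → coeffOuter-Weil-suc W-reduced j)

    Weil-D-expansion : Weil (suc (suc s)) ≃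
                       sumTo n (λ k → lift (bracket (suc s) (D k) W) *P pow (var (suc (suc s)) (suc s)) k)
    Weil-D-expansion = P.trans Weil≃monomials (P.reflexive
      (≡.cong₂ (λ x y → sumTo n (λ k → lift (reduceAll (suc s) (eval (D k) x *P W)) *P pow y k))
               (≡.sym (var-last s)) (≡.sym (var-last (suc s)))))

    coeffOuter-Weil-last : coeffOuter (Weil (suc (suc s))) m ≃ W
    coeffOuter-Weil-last = C.trans (coeffOuter-Weil-suc W-reduced m)
      (C.trans (reduceAll-cong (suc s) (C.trans (C.*-congʳ {W} XM.δ-last) (C.*-identityˡ W))) (reduceAll-fix W-reduced))

    b : ℕ → MPoly (suc s)
    b k = bracket (suc s) (tpow k) W

    b≃ : ∀ k → b k ≃ reduceAll (suc s) (pow X.Y k *P W)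
    b≃ k = reduceAll-cong (suc s) (C.*-congʳ {W}
      (C.trans (C.reflexive (≡.cong (eval (tpow k)) (var-last s))) (Polynomials.eval-tpow (suc s) k X.Y)))

    B≃ : ∀ j → B j ≃ sumTo n (λ k → b k *P embed (suc s) (coef (k + j + 1)))
    B≃ j = begin
      reduceAll (suc s) (XM.δ j *P W)
        ≈⟨ reduceAll-cong (suc s) (C.trans (C.*-congʳ {W} δ≃monomials) (sumTo-*ʳ n _ W)) ⟩
      reduceAll (suc s) (sumTo n (λ k → (lift (aⱼ₊ k) *P pow X.Y k) *P W))
        ≈⟨ reduceAll-sumTo (suc s) n _ ⟩
      sumTo n (λ k → reduceAll (suc s) ((lift (aⱼ₊ k) *P pow X.Y k) *P W))
        ≈⟨ sumTo-cong n (λ k → C.trans (reduceAll-cong (suc s) (C.*-assoc (lift (aⱼ₊ k)) (pow X.Y k) W))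
             (C.trans (reduceAll-embed* (suc s) (coef (j + k + 1)) (pow X.Y k *P W))
             (C.trans (C.*-comm (lift (aⱼ₊ k)) (reduceAll (suc s) (pow X.Y k *P W)))
                      (C.*-cong (C.sym (b≃ k)) (C.reflexive (≡.cong (λ i → embed (suc s) (coef (i + 1))) (+-comm j k))))))) ⟩
      sumTo n (λ k → b k *P embed (suc s) (coef (k + j + 1)))
        ∎
      where
      open ≈-Reasoning C.setoid
      open Polynomials (suc s)
      aⱼ₊ : ℕ → MPoly s
      aⱼ₊ k = embed s (coef (j + k + 1))
      δ≃monomials : XM.δ j ≃ X.monomials n aⱼ₊
      δ≃monomials = X.≃-monomials (XM.δ j) aⱼ₊ (XM.δ-bounded j) (λ k _ → XM.coeffOuter-δ j k)

    RHS₃ : MPoly (suc (suc s))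
    RHS₃ = sumTo n (λ k → lift (b k) *P YM.δ k)

    coeffOuter-RHS₃ : ∀ j → coeffOuter RHS₃ j ≃ sumTo n (λ k → b k *P embed (suc s) (coef (k + j + 1)))
    coeffOuter-RHS₃ j = C.trans (Y.coeffOuter-sumTo n (λ k → lift (b k) *P YM.δ k) j)
      (Polynomials.sumTo-cong (suc s) n λ k →
        C.trans (Y.coeffOuter-lift* (b k) (YM.δ k) j) (C.*-congˡ {b k} (YM.coeffOuter-δ k j)))

    RHS₃≃monomials : RHS₃ ≃ Y.monomials n B
    RHS₃≃monomials = Y.≃-monomials RHS₃ B
      (λ j n≤j → C.trans (coeffOuter-RHS₃ j) (Polynomials.sumTo-≃0 (suc s) n λ k →
        C.trans (C.*-congˡ {b k} (C.trans (C.reflexive (≡.cong (embed (suc s)) (coef-beyond (≤-trans n≤j (m≤n+m j k)))))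
                                          (embed-0# (suc s))))
                (C.zeroʳ (b k))))
      (λ j _ → C.trans (coeffOuter-RHS₃ j) (C.sym (B≃ j)))

    Weil-tpow-expansion : Weil (suc (suc s)) ≃
                          sumTo n (λ k → lift (bracket (suc s) (tpow k) W) *P eval (D k) (var (suc (suc s)) (suc s)))
    Weil-tpow-expansion = P.trans Weil≃monomials (P.trans (P.sym RHS₃≃monomials)
      (P.reflexive (≡.cong (λ y → sumTo n (λ k → lift (b k) *P eval (D k) y)) (≡.sym (var-last (suc s))))))


corollary2p13 : ∀ {c ℓ} (R : CommutativeRing c ℓ) → IsFiniteField R →
    (m : ℕ) (a : Vec (CommutativeRing.Carrier R) (suc m)) (r : ℕ) → 1 ≤ r →
    let open Weil R a in
      (Weil (suc r) ≈P sumTo n (λ k → lift (bracket r (D k) (Weil r)) *P pow (var (suc r) r) k))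
      × (coeffOuter (Weil (suc r)) (n ∸ 1) ≈P Weil r)
      × (Weil (suc r) ≈P sumTo n (λ k → lift (bracket r (tpow k) (Weil r)) *P eval (D k) (var (suc r) r)))
corollary2p13 R _ m a (suc s) _ = ≃⇒≈P Weil-D-expansion , ≃⇒≈P coeffOuter-Weil-last , ≃⇒≈P Weil-tpow-expansion
  where
  open WeilOperatorProperties R a using (≃⇒≈P)
  open WeilOperatorProperties.Expansions R a s
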